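{- Let $p$ be an odd prime, and let $Q(x) = x^p + 1$ or $Q(x) = x^p - 1$. Let $n_0 \ge 0$ be an integer exceeding every positive integer zero of $Q$, and define $t_{n_0} = 1$, $t_n = Q(n)\,t_{n-1}$ for $n > n_0$. Then $$\nu_p(t_n) \sim \frac{(2p-1)\,n}{p(p-1)} \quad \text{as } n\to\infty.$$ Moreover, if $q$ is a prime with $q \neq p$, then $$\nu_q(t_n) \sim \frac{\gcd(p, q-1)\, n}{q-1} \quad \text{as } n\to\infty.$$
   Context: For a prime $\ell$ and nonzero rational $y$, $\nu_\ell(y)$ is the exponent of $\ell$ in $y$: $y = \ell^{\nu_\ell(y)} a/b$ with $a,b\in\mathbb{Z}$ not divisible by $\ell$. $a_n \sim b_n$ means $a_n/b_n \to 1$. -}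

module Defs where

open import Data.Nat using (ℕ; zero; suc; _+_; _*_; _∸_; _^_; _≤_; _<_; _≤?_)
open import Data.Nat.Divisibility using (_∣?_; divides)
open import Data.Integer using (+_)
open import Data.Rational using (ℚ; 0ℚ; 1ℚ; _÷_; ≢-nonZero; ∣_∣; _-_; _<_; _/_)
open import Data.Rational.Properties using (_≟_)
open import Data.Product using (Σ; _×_)
open import Relation.Nullary using (yes; no)

-- ℓ-adic valuation of a natural number m (with fuel; fuel = m suffices
-- for m ≥ 1 and ℓ ≥ 2).  Convention: νnat ℓ 0 = 0 (never used).
val-go : ℕ → ℕ → ℕ → ℕ
val-go ℓ m zero = 0
val-go ℓ m (suc fuel) with ℓ ∣? m
... | yes (divides q _) = suc (val-go ℓ q fuel)
... | no _ = 0

ν : ℕ → ℕ → ℕ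
ν ℓ m = val-go ℓ m m

toℚ : ℕ → ℚ
toℚ n = (+ n) / 1

-- total division on ℚ (x / 0 := 0; only used where the denominator is
-- eventually nonzero)
_÷₀_ : ℚ → ℚ → ℚ
a ÷₀ b with b ≟ 0ℚ
... | yes _ = 0ℚ
... | no b≢0 = _÷_ a b {{≢-nonZero b≢0}}

TendsTo : (ℕ → ℚ) → ℚ → Set
TendsTo a L = ∀ (ε : ℚ) → 0ℚ Data.Rational.< ε →
  Σ ℕ λ N → ∀ n → N ≤ n → ∣ a n - L ∣ Data.Rational.< ε

_∼_ : (ℕ → ℚ) → (ℕ → ℚ) → Set
a ∼ b = TendsTo (λ n → a n ÷₀ b n) 1ℚ

data PM : Set where
  plus minus : PM

Q : PM → ℕ → ℕ → ℕ
Q plus  p x = x ^ p + 1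
Q minus p x = x ^ p ∸ 1   -- exact for x ≥ 1, the only values used

-- t_{n₀} = 1, t_n = Q(n) t_{n-1} for n > n₀ (value for n < n₀ is 1, unused)
t : PM → ℕ → ℕ → ℕ → ℕ
t s p n₀ zero = 1
t s p n₀ (suc n) with n₀ ≤? n
... | yes _ = Q s p (suc n) * t s p n₀ n
... | no _  = 1

module Submission where

-- Write Q(k) = |k^p - τ| with τ = ±1.  Then
--   ν_q(t_n) = Σ_{n₀<k≤n} ν_q(Q(k)) = Σ_{j≥0} #{n₀ < k ≤ n | q^(j+1) ∣ k^p - τ},
-- and only the levels j < J = p · L n (L = binary length) contribute.  Each
-- level counts a periodic set: for q ≠ p it has g = gcd(p, q-1) roots per
-- period q^(j+1) (count mod q by Lagrange + Fermat + Bézout, then Hensel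
-- lifting); for q = p it is one residue class mod p^max(j,1) (lifting the
-- exponent).  So ν_q(t_n) equals a Legendre-type sum Σ_j r_j ⌊n/d_j⌋ up to
-- O(L n), and these sums are (g/(q-1)) n resp. (1/p + 1/(p-1)) n up to O(L n).
-- Since L n = o(n), the resulting integer bounds |D ν - A n| ≤ K (L n + 1)
-- give the asymptotic equivalences.

module FiniteSums where

  open import Data.Nat
  open import Data.Nat.Properties
  open import Data.Nat.DivMod
  open import Data.Nat.Divisibility using (_∣_; _∣0; ∣m∣n⇒∣m+n)
  open import Relation.Nullary
  open import Relation.Binary.PropositionalEquality
  open import Data.Empty

  Σ< : ℕ → (ℕ → ℕ) → ℕ
  Σ< zero f = 0
  Σ< (suc n) f = f 0 + Σ< n (λ i → f (suc i))

  χ : ∀ {A : Set} → Dec A → ℕ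
  χ (yes _) = 1
  χ (no _) = 0

  χ≤1 : ∀ {A : Set} (d : Dec A) → χ d ≤ 1
  χ≤1 (yes _) = s≤s z≤n
  χ≤1 (no _) = z≤n

  χ-cong : ∀ {A B : Set} (a : Dec A) (b : Dec B) → (A → B) → (B → A) → χ a ≡ χ b
  χ-cong (yes _) (yes _) f g = refl
  χ-cong (yes x) (no y) f g = ⊥-elim (y (f x))
  χ-cong (no x) (yes y) f g = ⊥-elim (x (g y))
  χ-cong (no _) (no _) f g = refl

  χ-yes : ∀ {A : Set} (a : Dec A) → A → χ a ≡ 1
  χ-yes (yes _) _ = refl
  χ-yes (no n) x = ⊥-elim (n x)

  χ-no : ∀ {A : Set} (a : Dec A) → ¬ A → χ a ≡ 0
  χ-no (yes x) n = ⊥-elim (n x)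
  χ-no (no _) _ = refl

  Σ-cong : ∀ n {f g : ℕ → ℕ} → (∀ i → i < n → f i ≡ g i) → Σ< n f ≡ Σ< n g
  Σ-cong zero h = refl
  Σ-cong (suc n) h = cong₂ _+_ (h 0 (s≤s z≤n)) (Σ-cong n (λ i i<n → h (suc i) (s≤s i<n)))

  Σ-ext : ∀ n {f g : ℕ → ℕ} → (∀ i → f i ≡ g i) → Σ< n f ≡ Σ< n g
  Σ-ext n h = Σ-cong n (λ i _ → h i)

  Σ-last : ∀ n (f : ℕ → ℕ) → Σ< (suc n) f ≡ Σ< n f + f n
  Σ-last zero f = +-comm (f 0) 0
  Σ-last (suc n) f = begin
    f 0 + Σ< (suc n) (λ i → f (suc i))         ≡⟨ cong (f 0 +_) (Σ-last n (λ i → f (suc i))) ⟩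
    f 0 + (Σ< n (λ i → f (suc i)) + f (suc n)) ≡⟨ sym (+-assoc (f 0) _ _) ⟩
    f 0 + Σ< n (λ i → f (suc i)) + f (suc n)   ∎
    where open ≡-Reasoning

  Σ-split : ∀ a b (f : ℕ → ℕ) → Σ< (a + b) f ≡ Σ< a f + Σ< b (λ i → f (a + i))
  Σ-split zero b f = refl
  Σ-split (suc a) b f = trans (cong (f 0 +_) (Σ-split a b (λ i → f (suc i)))) (sym (+-assoc (f 0) _ _))

  Σ-+ : ∀ n (f g : ℕ → ℕ) → Σ< n (λ i → f i + g i) ≡ Σ< n f + Σ< n g
  Σ-+ zero f g = refl
  Σ-+ (suc n) f g = trans (cong ((f 0 + g 0) +_) (Σ-+ n (λ i → f (suc i)) (λ i → g (suc i))))
                          (+-interchange (f 0) (g 0) _ _)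
    where
    +-interchange : ∀ a b c d → a + b + (c + d) ≡ a + c + (b + d)
    +-interchange a b c d = begin
      a + b + (c + d)   ≡⟨ +-assoc a b (c + d) ⟩
      a + (b + (c + d)) ≡⟨ cong (a +_) (sym (+-assoc b c d)) ⟩
      a + (b + c + d)   ≡⟨ cong (λ z → a + (z + d)) (+-comm b c) ⟩
      a + (c + b + d)   ≡⟨ cong (a +_) (+-assoc c b d) ⟩
      a + (c + (b + d)) ≡⟨ sym (+-assoc a c (b + d)) ⟩
      a + c + (b + d)   ∎
      where open ≡-Reasoning

  Σ-const : ∀ n c → Σ< n (λ _ → c) ≡ n * c
  Σ-const zero c = refl
  Σ-const (suc n) c = cong (c +_) (Σ-const n c)

  Σ-zero : ∀ n → Σ< n (λ _ → 0) ≡ 0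
  Σ-zero n = trans (Σ-const n 0) (*-zeroʳ n)

  Σ-*ˡ : ∀ n c (f : ℕ → ℕ) → Σ< n (λ i → c * f i) ≡ c * Σ< n f
  Σ-*ˡ zero c f = sym (*-zeroʳ c)
  Σ-*ˡ (suc n) c f = trans (cong (c * f 0 +_) (Σ-*ˡ n c (λ i → f (suc i)))) (sym (*-distribˡ-+ c (f 0) _))

  Σ-swap : ∀ a b (g : ℕ → ℕ → ℕ) → Σ< a (λ t → Σ< b (λ x → g t x)) ≡ Σ< b (λ x → Σ< a (λ t → g t x))
  Σ-swap zero b g = sym (Σ-zero b)
  Σ-swap (suc a) b g = begin
    Σ< b (g 0) + Σ< a (λ t → Σ< b (λ x → g (suc t) x)) ≡⟨ cong (Σ< b (g 0) +_) (Σ-swap a b (λ t → g (suc t))) ⟩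
    Σ< b (g 0) + Σ< b (λ x → Σ< a (λ t → g (suc t) x)) ≡⟨ sym (Σ-+ b (g 0) (λ x → Σ< a (λ t → g (suc t) x))) ⟩
    Σ< b (λ x → g 0 x + Σ< a (λ t → g (suc t) x))      ∎
    where open ≡-Reasoning

  Σ-blocks : ∀ c M (f : ℕ → ℕ) → Σ< (c * M) f ≡ Σ< c (λ t → Σ< M (λ x → f (t * M + x)))
  Σ-blocks zero M f = refl
  Σ-blocks (suc c) M f = begin
    Σ< (M + c * M) f                                       ≡⟨ Σ-split M (c * M) f ⟩
    Σ< M f + Σ< (c * M) (λ i → f (M + i))                  ≡⟨ cong (Σ< M f +_) (Σ-blocks c M (λ i → f (M + i))) ⟩
    Σ< M f + Σ< c (λ t → Σ< M (λ x → f (M + (t * M + x)))) ≡⟨ cong (Σ< M f +_) (Σ-ext c (λ t → Σ-ext M (λ x → cong f (sym (+-assoc M (t * M) x))))) ⟩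
    Σ< M f + Σ< c (λ t → Σ< M (λ x → f (M + t * M + x)))   ∎
    where open ≡-Reasoning

  Σ-mono : ∀ n {f g : ℕ → ℕ} → (∀ i → i < n → f i ≤ g i) → Σ< n f ≤ Σ< n g
  Σ-mono zero h = z≤n
  Σ-mono (suc n) h = +-mono-≤ (h 0 (s≤s z≤n)) (Σ-mono n (λ i i<n → h (suc i) (s≤s i<n)))

  Σ-monoN : ∀ m n (f : ℕ → ℕ) → m ≤ n → Σ< m f ≤ Σ< n f
  Σ-monoN m n f m≤n = begin
    Σ< m f                                  ≤⟨ m≤m+n (Σ< m f) _ ⟩
    Σ< m f + Σ< (n ∸ m) (λ i → f (m + i))  ≡⟨ sym (Σ-split m (n ∸ m) f) ⟩
    Σ< (m + (n ∸ m)) f                      ≡⟨ cong (λ z → Σ< z f) (m+[n∸m]≡n m≤n) ⟩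
    Σ< n f                                  ∎
    where open ≤-Reasoning

  Σ-dvd : ∀ n d (f : ℕ → ℕ) → (∀ i → i < n → d ∣ f i) → d ∣ Σ< n f
  Σ-dvd zero d f h = d ∣0
  Σ-dvd (suc n) d f h = ∣m∣n⇒∣m+n (h 0 (s≤s z≤n)) (Σ-dvd n d (λ i → f (suc i)) (λ i i<n → h (suc i) (s≤s i<n)))

  count0 : ∀ N {P : ℕ → Set} (P? : ∀ t → Dec (P t)) → (∀ t → t < N → ¬ P t) → Σ< N (λ t → χ (P? t)) ≡ 0
  count0 N P? h = trans (Σ-cong N (λ t t<N → χ-no (P? t) (h t t<N))) (Σ-zero N)

  count1 : ∀ N {P : ℕ → Set} (P? : ∀ t → Dec (P t)) t0 → (∀ t → t < N → P t → t ≡ t0) → t0 < N → P t0 →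
           Σ< N (λ t → χ (P? t)) ≡ 1
  count1 zero P? t0 u () p
  count1 (suc N) {P} P? t0 u t0<N p with t0 ≟ N
  ... | yes refl = begin
        Σ< (suc N) (λ t → χ (P? t))         ≡⟨ Σ-last N _ ⟩
        Σ< N (λ t → χ (P? t)) + χ (P? N)    ≡⟨ cong₂ _+_ (count0 N P? (λ t t<N pt → <-irrefl (u t (m<n⇒m<1+n t<N) pt) t<N)) (χ-yes (P? N) p) ⟩
        1                                   ∎
    where open ≡-Reasoning
  ... | no t0≢N = begin
        Σ< (suc N) (λ t → χ (P? t))         ≡⟨ Σ-last N _ ⟩
        Σ< N (λ t → χ (P? t)) + χ (P? N)    ≡⟨ cong₂ _+_ (count1 N P? t0 (λ t t<N pt → u t (m<n⇒m<1+n t<N) pt) (≤∧≢⇒< (≤-pred t0<N) t0≢N) p)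
                                                         (χ-no (P? N) (λ pN → t0≢N (sym (u N ≤-refl pN)))) ⟩
        1                                   ∎
    where open ≡-Reasoning

  count≤1 : ∀ N {P : ℕ → Set} (P? : ∀ t → Dec (P t)) → (∀ t t' → t < N → t' < N → P t → P t' → t ≡ t') →
            Σ< N (λ t → χ (P? t)) ≤ 1
  count≤1 zero P? u = z≤n
  count≤1 (suc N) P? u with P? N
  ... | yes pN = ≤-reflexive (count1 (suc N) P? N (λ t t<N pt → u t N t<N ≤-refl pt pN) ≤-refl pN)
  ... | no ¬pN = begin
        Σ< (suc N) (λ t → χ (P? t))         ≡⟨ Σ-last N _ ⟩
        Σ< N (λ t → χ (P? t)) + χ (P? N)    ≡⟨ cong (Σ< N (λ t → χ (P? t)) +_) (χ-no (P? N) ¬pN) ⟩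
        Σ< N (λ t → χ (P? t)) + 0           ≡⟨ +-identityʳ _ ⟩
        Σ< N (λ t → χ (P? t))               ≤⟨ count≤1 N P? (λ t t' t<N t'<N → u t t' (m<n⇒m<1+n t<N) (m<n⇒m<1+n t'<N)) ⟩
        1                                   ∎
    where open ≤-Reasoning

  count-lower : ∀ N {P : ℕ → Set} (P? : ∀ t → Dec (P t)) k (ρ : ℕ → ℕ) →
    (∀ i → i < k → ρ i < N) → (∀ i → i < k → P (ρ i)) →
    (∀ i i' → i < k → i' < k → ρ i ≡ ρ i' → i ≡ i') →
    k ≤ Σ< N (λ t → χ (P? t))
  count-lower N {P} P? k ρ bd pρ inj = begin
    k                                          ≡⟨ sym (*-identityʳ k) ⟩
    k * 1                                      ≡⟨ sym (Σ-const k 1) ⟩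
    Σ< k (λ i → 1)                             ≡⟨ sym (Σ-cong k (λ i i<k → count1 N (λ t → t ≟ ρ i) (ρ i) (λ t _ e → e) (bd i i<k) refl)) ⟩
    Σ< k (λ i → Σ< N (λ t → χ (t ≟ ρ i)))      ≡⟨ Σ-swap k N (λ i t → χ (t ≟ ρ i)) ⟩
    Σ< N (λ t → Σ< k (λ i → χ (t ≟ ρ i)))      ≤⟨ Σ-mono N hit-once ⟩
    Σ< N (λ t → χ (P? t))                      ∎
    where
    open ≤-Reasoning
    -- each t < N equals at most one ρ i, and only if P t holds
    hit-once : ∀ t → t < N → Σ< k (λ i → χ (t ≟ ρ i)) ≤ χ (P? t)
    hit-once t _ with P? t
    ... | yes _ = count≤1 k (λ i → t ≟ ρ i) (λ i i' i<k i'<k e e' → inj i i' i<k i'<k (trans (sym e) e'))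
    ... | no ¬p = ≤-reflexive (count0 k (λ i → t ≟ ρ i) (λ i i<k e → ¬p (subst P (sym e) (pρ i i<k))))

  countLt : ∀ n m → Σ< n (λ i → χ (i <? m)) ≡ n ⊓ m
  countLt zero m = refl
  countLt (suc n) m with n <? m
  ... | yes n<m = begin
       Σ< (suc n) (λ i → χ (i <? m))           ≡⟨ Σ-last n _ ⟩
       Σ< n (λ i → χ (i <? m)) + χ (n <? m)    ≡⟨ cong₂ _+_ (countLt n m) (χ-yes (n <? m) n<m) ⟩
       n ⊓ m + 1                               ≡⟨ cong (_+ 1) (m≤n⇒m⊓n≡m (<⇒≤ n<m)) ⟩
       n + 1                                   ≡⟨ +-comm n 1 ⟩
       suc n                                   ≡⟨ sym (m≤n⇒m⊓n≡m n<m) ⟩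
       suc n ⊓ m                               ∎
    where open ≡-Reasoning
  ... | no n≮m = begin
       Σ< (suc n) (λ i → χ (i <? m))           ≡⟨ Σ-last n _ ⟩
       Σ< n (λ i → χ (i <? m)) + χ (n <? m)    ≡⟨ cong₂ _+_ (countLt n m) (χ-no (n <? m) n≮m) ⟩
       n ⊓ m + 0                               ≡⟨ +-identityʳ _ ⟩
       n ⊓ m                                   ≡⟨ m≥n⇒m⊓n≡n (≮⇒≥ n≮m) ⟩
       m                                       ≡⟨ sym (m≥n⇒m⊓n≡n (m≤n⇒m≤1+n (≮⇒≥ n≮m))) ⟩
       suc n ⊓ m                               ∎
    where open ≡-Reasoning

  -- Sums of a function f of period M: every complete period contributes the
  -- block sum Σ< M f, so Σ< n f lies between ⌊n/M⌋ and ⌊n/M⌋ + 1 block sums.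
  module Periodic (M : ℕ) (f : ℕ → ℕ) (per : ∀ i → f (i + M) ≡ f i) where

    per-mult : ∀ k i → f (k * M + i) ≡ f i
    per-mult zero i = refl
    per-mult (suc k) i = begin
      f (M + k * M + i) ≡⟨ cong f (trans (+-assoc M (k * M) i) (+-comm M (k * M + i))) ⟩
      f (k * M + i + M) ≡⟨ per (k * M + i) ⟩
      f (k * M + i)     ≡⟨ per-mult k i ⟩
      f i               ∎
      where open ≡-Reasoning

    Σ-periods : ∀ k → Σ< (k * M) f ≡ k * Σ< M f
    Σ-periods k = begin
      Σ< (k * M) f                                ≡⟨ Σ-blocks k M f ⟩
      Σ< k (λ t → Σ< M (λ x → f (t * M + x)))     ≡⟨ Σ-ext k (λ t → Σ-ext M (λ x → per-mult t x)) ⟩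
      Σ< k (λ t → Σ< M f)                         ≡⟨ Σ-const k _ ⟩
      k * Σ< M f                                  ∎
      where open ≡-Reasoning

    Σ-period-shift : Σ< M (λ i → f (suc i)) ≡ Σ< M f
    Σ-period-shift = +-cancelˡ-≡ (f 0) _ _
      (trans (Σ-last M f) (trans (cong (Σ< M f +_) (per 0)) (+-comm _ (f 0))))

    module _ .{{_ : NonZero M}} where

      Σ-per-lower : ∀ n → (n / M) * Σ< M f ≤ Σ< n f
      Σ-per-lower n = begin
        (n / M) * Σ< M f      ≡⟨ sym (Σ-periods (n / M)) ⟩
        Σ< ((n / M) * M) f    ≤⟨ Σ-monoN _ _ f (m/n*n≤m n M) ⟩
        Σ< n f                ∎
        where open ≤-Reasoning

      Σ-per-upper : ∀ n → Σ< n f ≤ (n / M) * Σ< M f + Σ< M f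
      Σ-per-upper n = begin
        Σ< n f                                                         ≡⟨ cong (λ z → Σ< z f) (trans (m≡m%n+[m/n]*n n M) (+-comm (n % M) _)) ⟩
        Σ< ((n / M) * M + n % M) f                                     ≡⟨ Σ-split ((n / M) * M) (n % M) f ⟩
        Σ< ((n / M) * M) f + Σ< (n % M) (λ i → f ((n / M) * M + i))    ≡⟨ cong₂ _+_ (Σ-periods (n / M)) (Σ-ext (n % M) (λ i → per-mult (n / M) i)) ⟩
        (n / M) * Σ< M f + Σ< (n % M) f                                ≤⟨ +-monoʳ-≤ ((n / M) * Σ< M f) (Σ-monoN (n % M) M f (<⇒≤ (m%n<n n M))) ⟩
        (n / M) * Σ< M f + Σ< M f                                      ∎
        where open ≤-Reasoning

  module _ (M : ℕ) .{{_ : NonZero M}} (f : ℕ → ℕ) (per : ∀ i → f (i + M) ≡ f i)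
           (r : ℕ) (blk : Σ< M f ≡ r) where

    private
      open module Shifted = Periodic M (λ i → f (suc i)) (λ i → per (suc i))
        using (Σ-per-lower; Σ-per-upper)

      shifted-blk : Σ< M (λ i → f (suc i)) ≡ r
      shifted-blk = trans (Periodic.Σ-period-shift M f per) blk

      ⌊n/M⌋-blocks : ∀ n → (n / M) * Σ< M (λ i → f (suc i)) ≡ r * (n / M)
      ⌊n/M⌋-blocks n = trans (cong ((n / M) *_) shifted-blk) (*-comm (n / M) r)

    periodic-count-lower : ∀ n → r * (n / M) ≤ Σ< n (λ i → f (suc i))
    periodic-count-lower n = subst (_≤ Σ< n (λ i → f (suc i))) (⌊n/M⌋-blocks n) (Σ-per-lower n)

    periodic-count-upper : ∀ n → Σ< n (λ i → f (suc i)) ≤ r * (n / M) + r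
    periodic-count-upper n = subst (Σ< n (λ i → f (suc i)) ≤_)
      (cong₂ _+_ (⌊n/M⌋-blocks n) shifted-blk) (Σ-per-upper n)

module Valuation where

  open import Defs
  open FiniteSums
  open import Data.Nat
  open import Data.Nat.Properties
  open import Data.Nat.Divisibility
  open import Data.Nat.Primality
  open import Data.Product
  open import Data.Sum
  open import Data.Empty
  open import Relation.Nullary
  open import Relation.Binary.PropositionalEquality

  prime≥2 : ∀ {q} → Prime q → 2 ≤ q
  prime≥2 {q} pq = nonTrivial⇒n>1 q {{prime⇒nonTrivial pq}}

  prime≥1 : ∀ {q} → Prime q → 1 ≤ q
  prime≥1 pq = ≤-trans (s≤s z≤n) (prime≥2 pq)

  val-go-spec : ∀ ℓ m fuel → 2 ≤ ℓ → 1 ≤ m → m ≤ fuel →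
                Σ ℕ (λ m' → (m ≡ ℓ ^ val-go ℓ m fuel * m') × ¬ (ℓ ∣ m'))
  val-go-spec ℓ m zero ℓ≥2 m≥1 m≤0 = ⊥-elim (<-irrefl refl (≤-trans m≥1 m≤0))
  val-go-spec ℓ m (suc fuel) ℓ≥2 m≥1 m≤f with ℓ ∣? m
  ... | no ℓ∤m = m , sym (+-identityʳ m) , ℓ∤m
  ... | yes (divides q eq) = m' , m≡ , ℓ∤m'
    where
    q≥1 : 1 ≤ q
    q≥1 = n≢0⇒n>0 (λ q≡0 → <-irrefl refl (≤-trans m≥1 (≤-reflexive (trans eq (cong (_* ℓ) q≡0)))))
    q<m : q < m
    q<m = begin-strict
      q       ≡⟨ sym (*-identityʳ q) ⟩
      q * 1   <⟨ *-monoʳ-< q {{>-nonZero q≥1}} {1} {ℓ} ℓ≥2 ⟩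
      q * ℓ   ≡⟨ sym eq ⟩
      m       ∎
      where open ≤-Reasoning
    rec : Σ ℕ (λ m' → (q ≡ ℓ ^ val-go ℓ q fuel * m') × ¬ (ℓ ∣ m'))
    rec = val-go-spec ℓ q fuel ℓ≥2 q≥1 (≤-pred (≤-trans q<m m≤f))
    m' : ℕ
    m' = proj₁ rec
    ℓ∤m' : ¬ (ℓ ∣ m')
    ℓ∤m' = proj₂ (proj₂ rec)
    m≡ : m ≡ ℓ * ℓ ^ val-go ℓ q fuel * m'
    m≡ = begin
      m                                  ≡⟨ eq ⟩
      q * ℓ                              ≡⟨ cong (_* ℓ) (proj₁ (proj₂ rec)) ⟩
      ℓ ^ val-go ℓ q fuel * m' * ℓ       ≡⟨ *-comm _ ℓ ⟩
      ℓ * (ℓ ^ val-go ℓ q fuel * m')     ≡⟨ sym (*-assoc ℓ _ m') ⟩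
      ℓ * ℓ ^ val-go ℓ q fuel * m'       ∎
      where open ≡-Reasoning

  ν-spec : ∀ ℓ m → 2 ≤ ℓ → 1 ≤ m → Σ ℕ (λ m' → (m ≡ ℓ ^ ν ℓ m * m') × ¬ (ℓ ∣ m'))
  ν-spec ℓ m ℓ≥2 m≥1 = val-go-spec ℓ m m ℓ≥2 m≥1 ≤-refl

  exponent-unique : ∀ ℓ v w a b → 1 ≤ ℓ → ℓ ^ v * a ≡ ℓ ^ w * b → ¬ (ℓ ∣ a) → ¬ (ℓ ∣ b) → v ≡ w
  exponent-unique ℓ zero zero a b _ eq ℓ∤a ℓ∤b = refl
  exponent-unique ℓ zero (suc w) a b _ eq ℓ∤a ℓ∤b =
    ⊥-elim (ℓ∤a (divides (ℓ ^ w * b) (trans (trans (sym (+-identityʳ a)) eq) (trans (*-assoc ℓ _ b) (*-comm ℓ _)))))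
  exponent-unique ℓ (suc v) zero a b _ eq ℓ∤a ℓ∤b =
    ⊥-elim (ℓ∤b (divides (ℓ ^ v * a) (trans (trans (sym (+-identityʳ b)) (sym eq)) (trans (*-assoc ℓ _ a) (*-comm ℓ _)))))
  exponent-unique ℓ (suc v) (suc w) a b ℓ≥1 eq ℓ∤a ℓ∤b =
    cong suc (exponent-unique ℓ v w a b ℓ≥1 (*-cancelˡ-≡ (ℓ ^ v * a) (ℓ ^ w * b) ℓ {{>-nonZero ℓ≥1}}
       (trans (sym (*-assoc ℓ _ a)) (trans eq (*-assoc ℓ _ b)))) ℓ∤a ℓ∤b)

  ν-char : ∀ ℓ m v m' → 2 ≤ ℓ → 1 ≤ m → m ≡ ℓ ^ v * m' → ¬ (ℓ ∣ m') → ν ℓ m ≡ v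
  ν-char ℓ m v m' ℓ≥2 m≥1 eq ℓ∤m' with ν-spec ℓ m ℓ≥2 m≥1
  ... | m'' , eq' , ℓ∤m'' = exponent-unique ℓ (ν ℓ m) v m'' m' (≤-trans (s≤s z≤n) ℓ≥2) (trans (sym eq') eq) ℓ∤m'' ℓ∤m'

  ν-one : ∀ ℓ → 2 ≤ ℓ → ν ℓ 1 ≡ 0
  ν-one ℓ ℓ≥2 = ν-char ℓ 1 0 1 ℓ≥2 ≤-refl refl (λ d → <-irrefl refl (≤-trans ℓ≥2 (∣⇒≤ d)))

  -- For a prime ℓ the valuation is additive (Euclid's lemma on the cofactors).
  ν-mul : ∀ ℓ a b → Prime ℓ → 1 ≤ a → 1 ≤ b → ν ℓ (a * b) ≡ ν ℓ a + ν ℓ b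
  ν-mul ℓ a b pℓ a≥1 b≥1 with ν-spec ℓ a (prime≥2 pℓ) a≥1 | ν-spec ℓ b (prime≥2 pℓ) b≥1
  ... | a' , ea , ℓ∤a' | b' , eb , ℓ∤b' =
    ν-char ℓ (a * b) (ν ℓ a + ν ℓ b) (a' * b') (prime≥2 pℓ) (*-mono-≤ a≥1 b≥1) ab≡ ℓ∤a'b'
    where
    interchange : ∀ x y z w → x * y * (z * w) ≡ x * z * (y * w)
    interchange x y z w = begin
      x * y * (z * w)   ≡⟨ *-assoc x y (z * w) ⟩
      x * (y * (z * w)) ≡⟨ cong (x *_) (sym (*-assoc y z w)) ⟩
      x * (y * z * w)   ≡⟨ cong (λ u → x * (u * w)) (*-comm y z) ⟩
      x * (z * y * w)   ≡⟨ cong (x *_) (*-assoc z y w) ⟩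
      x * (z * (y * w)) ≡⟨ sym (*-assoc x z (y * w)) ⟩
      x * z * (y * w)   ∎
      where open ≡-Reasoning
    ab≡ : a * b ≡ ℓ ^ (ν ℓ a + ν ℓ b) * (a' * b')
    ab≡ = begin
      a * b                                 ≡⟨ cong₂ _*_ ea eb ⟩
      ℓ ^ ν ℓ a * a' * (ℓ ^ ν ℓ b * b')     ≡⟨ interchange (ℓ ^ ν ℓ a) a' (ℓ ^ ν ℓ b) b' ⟩
      ℓ ^ ν ℓ a * ℓ ^ ν ℓ b * (a' * b')     ≡⟨ cong (_* (a' * b')) (sym (^-distribˡ-+-* ℓ (ν ℓ a) (ν ℓ b))) ⟩
      ℓ ^ (ν ℓ a + ν ℓ b) * (a' * b')       ∎
      where open ≡-Reasoning
    ℓ∤a'b' : ¬ (ℓ ∣ a' * b')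
    ℓ∤a'b' d = [ ℓ∤a' , ℓ∤b' ]′ (euclidsLemma a' b' pℓ d)

  ^∣⇒≤ν : ∀ ℓ m j → Prime ℓ → 1 ≤ m → ℓ ^ j ∣ m → j ≤ ν ℓ m
  ^∣⇒≤ν ℓ m j pℓ m≥1 ℓʲ∣m with ν-spec ℓ m (prime≥2 pℓ) m≥1
  ... | m' , eq , ℓ∤m' with j ≤? ν ℓ m
  ...   | yes j≤ = j≤
  ...   | no j≰ = ⊥-elim (ℓ∤m' (*-cancelˡ-∣ (ℓ ^ v) {{m^n≢0 ℓ v {{>-nonZero (prime≥1 pℓ)}}}} ℓᵛ⁺¹∣))
    where
    v : ℕ
    v = ν ℓ m
    v+1≤j : v + 1 ≤ j
    v+1≤j = subst (_≤ j) (+-comm 1 v) (≰⇒> j≰)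
    ℓᵛ⁺¹∣ℓʲ : ℓ ^ (v + 1) ∣ ℓ ^ j
    ℓᵛ⁺¹∣ℓʲ = subst (λ z → ℓ ^ (v + 1) ∣ ℓ ^ z) (m+[n∸m]≡n v+1≤j)
                (divides (ℓ ^ (j ∸ (v + 1))) (trans (^-distribˡ-+-* ℓ (v + 1) (j ∸ (v + 1))) (*-comm (ℓ ^ (v + 1)) _)))
    ℓᵛ⁺¹∣ : ℓ ^ v * ℓ ∣ ℓ ^ v * m'
    ℓᵛ⁺¹∣ = subst₂ _∣_ (trans (^-distribˡ-+-* ℓ v 1) (cong (ℓ ^ v *_) (*-identityʳ ℓ))) eq (∣-trans ℓᵛ⁺¹∣ℓʲ ℓʲ∣m)

  ≤ν⇒^∣ : ∀ ℓ m j → Prime ℓ → 1 ≤ m → j ≤ ν ℓ m → ℓ ^ j ∣ m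
  ≤ν⇒^∣ ℓ m j pℓ m≥1 j≤ with ν-spec ℓ m (prime≥2 pℓ) m≥1
  ... | m' , eq , _ =
    ∣-trans (divides (ℓ ^ (ν ℓ m ∸ j)) (trans (cong (ℓ ^_) (sym (m+[n∸m]≡n j≤))) (trans (^-distribˡ-+-* ℓ j _) (*-comm (ℓ ^ j) _))))
            (divides m' (trans eq (*-comm _ m')))

  ν-sum : ∀ ℓ m J → Prime ℓ → 1 ≤ m → m < ℓ ^ suc J →
          ν ℓ m ≡ Σ< J (λ i → χ (ℓ ^ suc i ∣? m))
  ν-sum ℓ m J pℓ m≥1 m< = begin
    ν ℓ m                                ≡⟨ sym (m≥n⇒m⊓n≡n ν≤J) ⟩
    J ⊓ ν ℓ m                            ≡⟨ sym (countLt J (ν ℓ m)) ⟩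
    Σ< J (λ i → χ (i <? ν ℓ m))          ≡⟨ Σ-ext J (λ i → χ-cong (i <? ν ℓ m) (ℓ ^ suc i ∣? m)
                                              (≤ν⇒^∣ ℓ m (suc i) pℓ m≥1) (^∣⇒≤ν ℓ m (suc i) pℓ m≥1)) ⟩
    Σ< J (λ i → χ (ℓ ^ suc i ∣? m))      ∎
    where
    open ≡-Reasoning
    ν≤J : ν ℓ m ≤ J
    ν≤J with ν ℓ m ≤? J
    ... | yes ν≤ = ν≤
    ... | no ν≰ = ⊥-elim (<-irrefl refl (≤-trans m< (≤-trans (^-monoʳ-≤ ℓ {{>-nonZero (prime≥1 pℓ)}} (≰⇒> ν≰))
                   (∣⇒≤ {{>-nonZero m≥1}} (≤ν⇒^∣ ℓ m (ν ℓ m) pℓ m≥1 ≤-refl)))))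

module Binomial where

  open FiniteSums
  open import Data.Nat
  open import Data.Nat.Properties
  open import Data.Nat.Divisibility
  open import Data.Nat.Primality
  open import Data.Product
  open import Data.Sum
  open import Data.Empty
  open import Relation.Nullary
  open import Relation.Binary.PropositionalEquality

  C : ℕ → ℕ → ℕ
  C n zero = 1
  C zero (suc k) = 0
  C (suc n) (suc k) = C n k + C n (suc k)

  C-big : ∀ n k → n < k → C n k ≡ 0
  C-big zero (suc k) _ = refl
  C-big (suc n) (suc k) (s≤s n<k) = cong₂ _+_ (C-big n k n<k) (C-big n (suc k) (m<n⇒m<1+n n<k))

  C-nn : ∀ n → C n n ≡ 1
  C-nn zero = refl
  C-nn (suc n) = trans (cong₂ _+_ (C-nn n) (C-big n (suc n) ≤-refl)) refl

  C-n1 : ∀ n → C n 1 ≡ n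
  C-n1 zero = refl
  C-n1 (suc n) = cong suc (C-n1 n)

  absorb : ∀ n k → suc k * C (suc n) (suc k) ≡ suc n * C n k
  absorb zero zero = refl
  absorb zero (suc k) = *-zeroʳ (suc (suc k))
  absorb (suc n) zero = begin
    1 * (C (suc n) 0 + C (suc n) 1) ≡⟨ *-identityˡ _ ⟩
    1 + C (suc n) 1 ≡⟨ cong suc (C-n1 (suc n)) ⟩
    suc (suc n) ≡⟨ sym (*-identityʳ _) ⟩
    suc (suc n) * 1 ∎
    where open ≡-Reasoning
  absorb (suc n) (suc k) = begin
    suc (suc k) * (C (suc n) (suc k) + C (suc n) (suc (suc k))) ≡⟨ *-distribˡ-+ (suc (suc k)) (C (suc n) (suc k)) (C (suc n) (suc (suc k))) ⟩
    suc (suc k) * C (suc n) (suc k) + suc (suc k) * C (suc n) (suc (suc k)) ≡⟨ cong (suc (suc k) * C (suc n) (suc k) +_) (absorb n (suc k)) ⟩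
    (C (suc n) (suc k) + suc k * C (suc n) (suc k)) + suc n * C n (suc k) ≡⟨ cong (λ z → (C (suc n) (suc k) + z) + suc n * C n (suc k)) (absorb n k) ⟩
    (C (suc n) (suc k) + suc n * C n k) + suc n * C n (suc k) ≡⟨ +-assoc (C (suc n) (suc k)) _ _ ⟩
    C (suc n) (suc k) + (suc n * C n k + suc n * C n (suc k)) ≡⟨ cong (C (suc n) (suc k) +_) (sym (*-distribˡ-+ (suc n) (C n k) _)) ⟩
    C (suc n) (suc k) + suc n * C (suc n) (suc k) ∎
    where open ≡-Reasoning

  -- For q prime and 0 < k < q, q divides C q k (by absorption and Euclid).
  prime∣C : ∀ q k → Prime q → 0 < k → k < q → q ∣ C q k
  prime∣C (suc n) (suc k) pq _ k<q with euclidsLemma (suc k) (C (suc n) (suc k)) pq (divides (C n k) (trans (absorb n k) (*-comm (suc n) _)))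
  ... | inj₂ d = d
  ... | inj₁ d = ⊥-elim (<-irrefl refl (≤-trans k<q (∣⇒≤ d)))

  binom : ∀ n x → (x + 1) ^ n ≡ Σ< (suc n) (λ k → C n k * x ^ k)
  binom zero x = refl
  binom (suc n) x = begin
    (x + 1) * (x + 1) ^ n                         ≡⟨ cong ((x + 1) *_) (binom n x) ⟩
    (x + 1) * B                                   ≡⟨ *-distribʳ-+ B x 1 ⟩
    x * B + 1 * B                                 ≡⟨ cong₂ _+_ (sym (Σ-*ˡ (suc n) x (λ k → C n k * x ^ k))) (*-identityˡ B) ⟩
    Σ< (suc n) (λ k → x * (C n k * x ^ k)) + B    ≡⟨ cong (_+ B) (Σ-ext (suc n) (λ k → x-inside (C n k) (x ^ k))) ⟩
    Sₖ + B                                         ≡⟨ cong (Sₖ +_) B≡1+Sₖ₊₁ ⟩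
    Sₖ + (1 + Sₖ₊₁)                                ≡⟨ trans (sym (+-assoc Sₖ 1 Sₖ₊₁)) (cong (_+ Sₖ₊₁) (+-comm Sₖ 1)) ⟩
    1 + Sₖ + Sₖ₊₁                                  ≡⟨ +-assoc 1 Sₖ Sₖ₊₁ ⟩
    1 + (Sₖ + Sₖ₊₁)                                ≡⟨ cong (1 +_) (sym (Σ-+ (suc n) (λ k → C n k * (x * x ^ k)) (λ k → C n (suc k) * (x * x ^ k)))) ⟩
    1 + Σ< (suc n) (λ k → C n k * (x * x ^ k) + C n (suc k) * (x * x ^ k))
                                                  ≡⟨ cong (1 +_) (Σ-ext (suc n) (λ k → sym (*-distribʳ-+ (x * x ^ k) (C n k) (C n (suc k))))) ⟩
    Σ< (suc (suc n)) (λ k → C (suc n) k * x ^ k)  ∎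
    where
    open ≡-Reasoning
    -- Pascal's rule splits the new coefficients into the two sums Sₖ, Sₖ₊₁.
    B Sₖ Sₖ₊₁ : ℕ
    B = Σ< (suc n) (λ k → C n k * x ^ k)
    Sₖ = Σ< (suc n) (λ k → C n k * (x * x ^ k))
    Sₖ₊₁ = Σ< (suc n) (λ k → C n (suc k) * (x * x ^ k))
    x-inside : ∀ a b → x * (a * b) ≡ a * (x * b)
    x-inside a b = trans (sym (*-assoc x a b)) (trans (cong (_* b) (*-comm x a)) (*-assoc a x b))
    B≡1+Sₖ₊₁ : B ≡ 1 + Sₖ₊₁
    B≡1+Sₖ₊₁ = begin
      B                                        ≡⟨ sym (+-identityʳ B) ⟩
      B + 0                                    ≡⟨ cong (B +_) (sym (cong (_* x ^ suc n) (C-big n (suc n) ≤-refl))) ⟩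
      B + C n (suc n) * x ^ suc n              ≡⟨ sym (Σ-last (suc n) (λ k → C n k * x ^ k)) ⟩
      Σ< (suc (suc n)) (λ k → C n k * x ^ k)   ≡⟨ cong (_+ Sₖ₊₁) (+-identityʳ 1) ⟩
      1 + Sₖ₊₁                                 ∎

  freshman : ∀ q x → Prime q → Σ ℕ (λ M → ((x + 1) ^ q ≡ 1 + M + x ^ q) × q ∣ M)
  freshman zero x pq = ⊥-elim (<-irrefl refl (≤-trans (s≤s z≤n) (nonTrivial⇒n>1 0 {{prime⇒nonTrivial pq}})))
  freshman (suc n) x pq = M , eq , dM
    where
    q M : ℕ
    q = suc n
    M = Σ< n (λ k → C q (suc k) * x ^ suc k)
    dM : q ∣ M
    dM = Σ-dvd n q _ (λ i i<n → ∣m⇒∣m*n (x ^ suc i) (prime∣C q (suc i) pq (s≤s z≤n) (s≤s i<n)))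
    eq : (x + 1) ^ q ≡ 1 + M + x ^ q
    eq = begin
      (x + 1) ^ q ≡⟨ binom q x ⟩
      1 + Σ< q (λ k → C q (suc k) * x ^ suc k) ≡⟨ cong (1 +_) (Σ-last n (λ k → C q (suc k) * x ^ suc k)) ⟩
      1 + (M + C q q * x ^ q) ≡⟨ cong (λ z → 1 + (M + z * x ^ q)) (C-nn q) ⟩
      1 + (M + 1 * x ^ q) ≡⟨ cong (λ z → 1 + (M + z)) (*-identityˡ (x ^ q)) ⟩
      1 + (M + x ^ q) ≡⟨ sym (+-assoc 1 M (x ^ q)) ⟩
      1 + M + x ^ q ∎
      where open ≡-Reasoning

module Congruence where

  open FiniteSums
  open Binomial
  open Valuation using (prime≥2; prime≥1)
  open import Data.Integer hiding (suc; pred)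
  open import Data.Integer.Properties
  open import Data.Integer.Divisibility.Signed
  open import Data.Integer.Tactic.RingSolver
  import Data.Integer.DivMod as ZDM
  open import Data.Nat as ℕ using (ℕ; zero; suc)
  import Data.Nat.Properties as ℕP
  import Data.Nat.Divisibility as ℕD
  open import Data.Nat.Primality
  open import Data.Nat.GCD using (module Bézout)
  open import Data.Nat.Coprimality using (Coprime; coprime-Bézout)
  open import Data.Product
  open import Data.Sum
  open import Data.Empty
  open import Relation.Nullary
  open import Relation.Nullary.Decidable using (map′)
  open import Relation.Binary.PropositionalEquality

  record Cg (m a b : ℤ) : Set where
    constructor cg
    field getCg : m ∣ (a - b)
  open Cg public

  dec∣ : ∀ m x → Dec (m ∣ x)
  dec∣ m x = map′ ∣ᵤ⇒∣ ∣⇒∣ᵤ (∣ m ∣ ℕD.∣? ∣ x ∣)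

  private
    a-a : ∀ a → a - a ≡ 0ℤ * a
    a-a = solve-∀
    neg-diff : ∀ a b → - (a - b) ≡ b - a
    neg-diff = solve-∀
    diff-trans : ∀ a b c → (a - b) + (b - c) ≡ a - c
    diff-trans = solve-∀
    diff-+ : ∀ a b c d → (a - b) + (c - d) ≡ (a + c) - (b + d)
    diff-+ = solve-∀
    diff-* : ∀ a b c d → c * (a - b) + b * (c - d) ≡ a * c - b * d
    diff-* = solve-∀
    diff-0 : ∀ x → x - 0ℤ ≡ x
    diff-0 = solve-∀
    diff-cancel : ∀ a b → (a - b) + b ≡ a
    diff-cancel = solve-∀

  Cg-refl : ∀ m a → Cg m a a
  Cg-refl m a = cg (divides 0ℤ (trans (a-a a) (trans (*-zeroˡ a) (sym (*-zeroˡ m)))))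

  Cg-reflexive : ∀ m {a b} → a ≡ b → Cg m a b
  Cg-reflexive m {a} refl = Cg-refl m a

  Cg-sym : ∀ {m a b} → Cg m a b → Cg m b a
  Cg-sym {m} {a} {b} (cg h) = cg (subst (m ∣_) (neg-diff a b) (∣m⇒∣-m h))

  Cg-trans : ∀ {m a b c} → Cg m a b → Cg m b c → Cg m a c
  Cg-trans {m} {a} {b} {c} (cg h1) (cg h2) = cg (subst (m ∣_) (diff-trans a b c) (∣m∣n⇒∣m+n h1 h2))

  Cg-+ : ∀ {m a b c d} → Cg m a b → Cg m c d → Cg m (a + c) (b + d)
  Cg-+ {m} {a} {b} {c} {d} (cg h1) (cg h2) = cg (subst (m ∣_) (diff-+ a b c d) (∣m∣n⇒∣m+n h1 h2))

  Cg-* : ∀ {m a b c d} → Cg m a b → Cg m c d → Cg m (a * c) (b * d)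
  Cg-* {m} {a} {b} {c} {d} (cg h1) (cg h2) = cg (subst (m ∣_) (diff-* a b c d) (∣m∣n⇒∣m+n (∣n⇒∣m*n c h1) (∣n⇒∣m*n b h2)))

  Cg-pow : ∀ {m a b} k → Cg m a b → Cg m (a ^ k) (b ^ k)
  Cg-pow {m} zero h = Cg-refl m 1ℤ
  Cg-pow (suc k) h = Cg-* h (Cg-pow k h)

  Cg-0 : ∀ {m x} → m ∣ x → Cg m x 0ℤ
  Cg-0 {m} {x} h = cg (subst (m ∣_) (sym (diff-0 x)) h)

  Cg-0' : ∀ {m x} → Cg m x 0ℤ → m ∣ x
  Cg-0' {m} {x} (cg h) = subst (m ∣_) (diff-0 x) h

  Cg-dvd : ∀ {m a b} → Cg m a b → m ∣ b → m ∣ a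
  Cg-dvd {m} {a} {b} (cg h) d = subst (m ∣_) (diff-cancel a b) (∣m∣n⇒∣m+n h d)

  nzpos : ∀ q → 1 ℕ.≤ q → NonZero (+ q)
  nzpos (suc q) _ = _

  cg-mod : ∀ q (q≥1 : 1 ℕ.≤ q) x → Cg (+ q) (+ (ZDM._%_ x (+ q) {{nzpos q q≥1}})) x
  cg-mod q q≥1 x = Cg-sym (cg (divides (ZDM._/_ x (+ q) {{nzpos q q≥1}})
    (trans (cong (_- + r) (ZDM.a≡a%n+[a/n]*n x (+ q) {{nzpos q q≥1}})) (r+b-r (+ r) _))))
    where r = ZDM._%_ x (+ q) {{nzpos q q≥1}}
          r+b-r : ∀ a b → a + b - a ≡ b
          r+b-r = solve-∀

  euclidℤ : ∀ {q} → Prime q → ∀ a b → ((+ q) ∣ a * b) → ((+ q) ∣ a) ⊎ ((+ q) ∣ b)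
  euclidℤ {q} pq a b d with euclidsLemma ∣ a ∣ ∣ b ∣ pq (subst (q ℕD.∣_) (abs-* a b) (∣⇒∣ᵤ d))
  ... | inj₁ x = inj₁ (∣ᵤ⇒∣ x)
  ... | inj₂ y = inj₂ (∣ᵤ⇒∣ y)

  ¬∣1 : ∀ {q} → Prime q → ¬ ((+ q) ∣ 1ℤ)
  ¬∣1 pq d = ℕP.<-irrefl refl (ℕP.≤-trans (prime≥2 pq) (ℕP.≤-reflexive (ℕD.∣1⇒≡1 (∣⇒∣ᵤ d))))

  ¬∣-1 : ∀ {q} → Prime q → ¬ ((+ q) ∣ -1ℤ)
  ¬∣-1 pq d = ¬∣1 pq (∣m⇒∣-m d)

  prime∣pow : ∀ {q} → Prime q → ∀ y n → (+ q) ∣ y ^ n → (+ q) ∣ y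
  prime∣pow pq y zero d = ⊥-elim (¬∣1 pq d)
  prime∣pow pq y (suc n) d with euclidℤ pq y (y ^ n) d
  ... | inj₁ x = x
  ... | inj₂ x = prime∣pow pq y n x

  ∣pow : ∀ {m} y n → 1 ℕ.≤ n → m ∣ y → m ∣ y ^ n
  ∣pow y (suc n) _ d = ∣m⇒∣m*n (y ^ n) d

  pow-pos : ∀ a n → (+ a) ^ n ≡ + (a ℕ.^ n)
  pow-pos a zero = refl
  pow-pos a (suc n) = trans (cong (+ a *_) (pow-pos a n)) (sym (pos-* a (a ℕ.^ n)))

  -- Fermat's little theorem x ^ q ≡ x (mod q), first for natural x by
  -- induction with the freshman's dream, then for every integer.
  fermatℕ : ∀ {q} → Prime q → ∀ x → Cg (+ q) ((+ x) ^ q) (+ x)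
  fermatℕ {q} pq zero = Cg-reflexive (+ q) (trans (pow-pos 0 q) (cong +_ (0^q q (prime≥1 pq))))
    where 0^q : ∀ q → 1 ℕ.≤ q → 0 ℕ.^ q ≡ 0
          0^q (suc q) _ = refl
  fermatℕ {q} pq (suc x) with freshman q x pq
  ... | M , eq , q∣M = cg (subst (+ q ∣_) (sym e) (∣m∣n⇒∣m+n (getCg (fermatℕ pq x)) (∣ᵤ⇒∣ q∣M)))
    where
    X : ℤ
    X = (+ x) ^ q
    rearrange : ∀ M X x → (+ 1 + M + X) - (x + + 1) ≡ (X - x) + M
    rearrange = solve-∀
    e : (+ suc x) ^ q - + suc x ≡ (X - + x) + + M
    e = begin
      (+ suc x) ^ q - + suc x                ≡⟨ cong (λ z → (+ z) ^ q - + z) (ℕP.+-comm 1 x) ⟩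
      (+ (x ℕ.+ 1)) ^ q - + (x ℕ.+ 1)        ≡⟨ cong (_- + (x ℕ.+ 1)) (pow-pos (x ℕ.+ 1) q) ⟩
      + ((x ℕ.+ 1) ℕ.^ q) - + (x ℕ.+ 1)      ≡⟨ cong (λ z → + z - + (x ℕ.+ 1)) eq ⟩
      + (1 ℕ.+ M ℕ.+ x ℕ.^ q) - + (x ℕ.+ 1)  ≡⟨ cong₂ _-_ (trans (pos-+ (1 ℕ.+ M) (x ℕ.^ q)) (cong₂ _+_ (pos-+ 1 M) (sym (pow-pos x q)))) (pos-+ x 1) ⟩
      (+ 1 + + M + X) - (+ x + + 1)          ≡⟨ rearrange (+ M) X (+ x) ⟩
      (X - + x) + + M                        ∎
      where open ≡-Reasoning

  -- Fermat for an arbitrary integer, through its residue x % q.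
  fermat : ∀ {q} → Prime q → ∀ x → Cg (+ q) (x ^ q) x
  fermat {q} pq x = Cg-trans (Cg-pow q (Cg-sym x≡r)) (Cg-trans (fermatℕ pq r) x≡r)
    where
    r : ℕ
    r = ZDM._%_ x (+ q) {{nzpos q (prime≥1 pq)}}
    x≡r : Cg (+ q) (+ r) x
    x≡r = cg-mod q (prime≥1 pq) x

  fermat' : ∀ {q} → Prime q → ∀ x → ¬ ((+ q) ∣ x) → Cg (+ q) (x ^ (q ℕ.∸ 1)) 1ℤ
  fermat' {zero} pq x q∤x = ⊥-elim (ℕP.<-irrefl refl (prime≥1 pq))
  fermat' {suc n} pq x q∤x =
    [ (λ q∣x → ⊥-elim (q∤x q∣x)) , cg ]′ (euclidℤ pq x (x ^ n - 1ℤ) (subst (+ suc n ∣_) (factor x (x ^ n)) (getCg (fermat pq x))))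
    where factor : ∀ x X → x * X - x ≡ x * (X - 1ℤ)
          factor = solve-∀

  pow-≡1-mult : ∀ {M} y n k → Cg M (y ^ n) 1ℤ → Cg M (y ^ (k ℕ.* n)) 1ℤ
  pow-≡1-mult {M} y n k h =
    subst₂ (Cg M) (trans (^-*-assoc y n k) (cong (y ^_) (ℕP.*-comm n k))) (^-zeroˡ k) (Cg-pow {M} {y ^ n} {1ℤ} k h)

  pow-≡1-suc : ∀ {M} y e → Cg M (y ^ e) 1ℤ → Cg M (y ^ suc e) y
  pow-≡1-suc {M} y e h = subst (Cg M (y * y ^ e)) (*-identityʳ y) (Cg-* {M} {y} {y} {y ^ e} {1ℤ} (Cg-refl M y) h)

  -- If y ^ m ≡ 1 and y ^ n ≡ 1 with m, n coprime then y ≡ 1: write a m = b n + 1.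
  bezout-pow : ∀ {M} m n → Coprime m n → ∀ y → Cg M (y ^ m) 1ℤ → Cg M (y ^ n) 1ℤ → Cg M y 1ℤ
  bezout-pow {M} m n c y hm hn with coprime-Bézout c
  ... | Bézout.+- a b eq = Cg-trans {M} (Cg-sym {M} (subst (λ z → Cg M (y ^ z) y) eq (pow-≡1-suc y (b ℕ.* n) (pow-≡1-mult y n b hn))))
                                    (pow-≡1-mult y m a hm)
  ... | Bézout.-+ a b eq = Cg-trans {M} (Cg-sym {M} (subst (λ z → Cg M (y ^ z) y) eq (pow-≡1-suc y (a ℕ.* m) (pow-≡1-mult y m a hm))))
                                    (pow-≡1-mult y n b hn)

module RootCounting where

  -- Polynomials are represented extensionally, as functions ℤ → ℤ admitting
  -- a Horner decomposition f x = c + x * g x of the stated degree.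

  open FiniteSums
  open Congruence
  open import Data.Integer hiding (suc; pred)
  open import Data.Integer.Properties
  open import Data.Integer.Divisibility.Signed
  open import Data.Integer.Tactic.RingSolver
  open import Data.Nat as ℕ using (ℕ; zero; suc)
  import Data.Nat.Properties as ℕP
  import Data.Nat.Divisibility as ℕD
  open import Data.Nat.Primality
  open import Data.List using (List; []; _∷_; length; map)
  open import Data.List.Properties using (length-map)
  open import Data.List.Relation.Unary.All as All using (All; []; _∷_)
  open import Data.List.Relation.Unary.AllPairs using (AllPairs; []; _∷_)
  open import Data.Product using (Σ; _×_; _,_)
  open import Data.Sum using (inj₁; inj₂)
  open import Data.Empty
  open import Relation.Nullary
  open import Relation.Binary.PropositionalEquality

  Poly : ℕ → (ℤ → ℤ) → Set
  Poly zero f = ∀ x → f x ≡ 0ℤ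
  Poly (suc n) f = Σ (ℤ → ℤ) λ g → Poly n g × Σ ℤ λ c → ∀ x → f x ≡ c + x * g x

  Monic : ℕ → (ℤ → ℤ) → Set
  Monic zero f = ∀ x → f x ≡ 1ℤ
  Monic (suc n) f = Σ (ℤ → ℤ) λ g → Monic n g × Σ ℤ λ c → ∀ x → f x ≡ c + x * g x

  Poly-scale : ∀ n a f → Poly n f → Poly n (λ x → a * f x)
  Poly-scale zero a f h x = trans (cong (a *_) (h x)) (*-zeroʳ a)
  Poly-scale (suc n) a f (g , pg , c , e) = (λ x → a * g x) , Poly-scale n a g pg , a * c ,
    λ x → trans (cong (a *_) (e x)) (distribute a c x (g x))
    where distribute : ∀ a c x G → a * (c + x * G) ≡ a * c + x * (a * G)
          distribute = solve-∀

  Monic⇒Poly : ∀ n f → Monic n f → Poly (suc n) f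
  Monic⇒Poly zero f h = (λ _ → 0ℤ) , (λ _ → refl) , 1ℤ , λ x → trans (h x) (sym (trans (cong (λ z → 1ℤ + z) (*-zeroʳ x)) refl))
  Monic⇒Poly (suc n) f (g , mg , c , e) = g , Monic⇒Poly n g mg , c , e

  Monic+Poly : ∀ n f r → Monic n f → Poly n r → Monic n (λ x → f x + r x)
  Monic+Poly zero f r mf pr x = trans (cong₂ _+_ (mf x) (pr x)) refl
  Monic+Poly (suc n) f r (g , mg , c , e) (h , ph , d , e') =
    (λ x → g x + h x) , Monic+Poly n g h mg ph , c + d ,
    λ x → trans (cong₂ _+_ (e x) (e' x)) (collect c d x (g x) (h x))
    where collect : ∀ c d x G H → (c + x * G) + (d + x * H) ≡ (c + d) + x * (G + H)
          collect = solve-∀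

  divide : ∀ m f → Monic (suc m) f → ∀ a → Σ (ℤ → ℤ) λ h → Monic m h × (∀ x → f x - f a ≡ (x - a) * h x)
  divide zero f (g , mg , c , e) a = (λ _ → 1ℤ) , (λ _ → refl) , λ x →
    trans (cong₂ _-_ (e x) (e a)) (trans (cong₂ (λ u v → (c + x * u) - (c + a * v)) (mg x) (mg a)) (difference c x a))
    where difference : ∀ c x a → (c + x * 1ℤ) - (c + a * 1ℤ) ≡ (x - a) * 1ℤ
          difference = solve-∀
  divide (suc m) f (g , mg , c , e) a with divide m g mg a
  ... | h' , mh' , eh' = (λ x → g x + a * h' x) ,
        Monic+Poly (suc m) g (λ x → a * h' x) mg (Poly-scale (suc m) a h' (Monic⇒Poly m h' mh')) ,
        λ x → trans (cong₂ _-_ (e x) (e a)) (trans (cong (λ v → (c + x * g x) - (c + a * v)) (ga x)) (difference c x a (g x) (h' x)))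
    where
    solve-for : ∀ G Ga D → G - Ga ≡ D → Ga ≡ G - D
    solve-for G Ga D eq = trans (double-negate G Ga) (cong (λ z → G - z) eq)
      where double-negate : ∀ G Ga → Ga ≡ G - (G - Ga)
            double-negate = solve-∀
    ga : ∀ x → g a ≡ g x - (x - a) * h' x
    ga x = solve-for (g x) (g a) _ (eh' x)
    difference : ∀ c x a G H → (c + x * G) - (c + a * (G - (x - a) * H)) ≡ (x - a) * (G + a * H)
    difference = solve-∀

  Monic-pow : ∀ k c → Monic (suc k) (λ x → x ^ suc k + c)
  Monic-pow zero c = (λ _ → 1ℤ) , (λ _ → refl) , c , λ x → +-comm (x * 1ℤ) c
  Monic-pow (suc k) c = (λ x → x ^ suc k + 0ℤ) , Monic-pow k 0ℤ , c , λ x → horner x (x ^ suc k) c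
    where horner : ∀ x X c → x * X + c ≡ c + x * (X + 0ℤ)
          horner = solve-∀

  rootBound : ∀ {q} → Prime q → ∀ m f → Monic m f → (rs : List ℤ) →
    All (λ r → (+ q) ∣ f r) rs → AllPairs (λ a b → ¬ Cg (+ q) a b) rs → length rs ℕ.≤ m
  rootBound pq m f mf [] _ _ = ℕ.z≤n
  rootBound pq zero f mf (a ∷ rs) (da ∷ _) _ = ⊥-elim (¬∣1 pq (subst (_ ∣_) (mf a) da))
  rootBound {q} pq (suc m) f mf (a ∷ rs) (da ∷ drs) (na ∷ nrs) with divide m f mf a
  ... | h , mh , eh = ℕ.s≤s (rootBound pq m h mh rs (All.zipWith step (drs , na)) nrs)
    where
    -- every other root b is, by Euclid, a root of the quotient h
    step : ∀ {b} → ((+ q) ∣ f b) × ¬ Cg (+ q) a b → (+ q) ∣ h b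
    step {b} (db , nab) with euclidℤ pq (b - a) (h b) (subst (_ ∣_) (eh b) (∣m∣n⇒∣m-n db da))
    ... | inj₁ d = ⊥-elim (nab (Cg-sym (cg d)))
    ... | inj₂ d = d

  Monic-pow' : ∀ k → 1 ℕ.≤ k → ∀ c → Monic k (λ x → x ^ k + c)
  Monic-pow' (suc k) _ c = Monic-pow k c

  resid-eq-ordered : ∀ {q} a b → a ℕ.≤ b → b ℕ.< q → + q ∣ + b - + a → b ≡ a
  resid-eq-ordered {q} a b a≤b b<q q∣ = ℕP.≤-antisym (ℕP.m∸n≡0⇒m≤n b∸a≡0) a≤b
    where
    q∣b∸a : q ℕD.∣ (b ℕ.∸ a)
    q∣b∸a = subst (q ℕD.∣_) (cong ∣_∣ (trans (m-n≡m⊖n b a) (⊖-≥ a≤b))) (∣⇒∣ᵤ q∣)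
    b∸a≡0 : b ℕ.∸ a ≡ 0
    b∸a≡0 with b ℕ.∸ a ℕP.≟ 0
    ... | yes e = e
    ... | no ne = ⊥-elim (ℕP.<-irrefl refl (ℕP.≤-trans (ℕP.≤-trans b<q (ℕD.∣⇒≤ {{ℕ.≢-nonZero ne}} q∣b∸a)) (ℕP.m∸n≤m b a)))

  resid-eq : ∀ {q} a b → a ℕ.< q → b ℕ.< q → Cg (+ q) (+ a) (+ b) → a ≡ b
  resid-eq a b a<q b<q c with ℕP.≤-total b a
  ... | inj₁ b≤a = resid-eq-ordered b a b≤a a<q (getCg c)
  ... | inj₂ a≤b = sym (resid-eq-ordered a b a≤b b<q (getCg (Cg-sym c)))

  module Witnesses {P : ℕ → Set} (P? : ∀ t → Dec (P t)) where
    witnesses : ℕ → List ℕ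
    witnesses zero = []
    witnesses (suc N) with P? N
    ... | yes _ = N ∷ witnesses N
    ... | no _ = witnesses N

    witnesses-length : ∀ N → length (witnesses N) ≡ Σ< N (λ t → χ (P? t))
    witnesses-length zero = refl
    witnesses-length (suc N) with P? N
    ... | yes p = trans (cong suc (witnesses-length N)) (trans (ℕP.+-comm 1 _) (trans (cong (Σ< N (λ t → χ (P? t)) ℕ.+_) (sym (χ-yes (P? N) p))) (sym (Σ-last N (λ t → χ (P? t))))))
    ... | no np = trans (witnesses-length N) (trans (sym (ℕP.+-identityʳ _)) (trans (cong (Σ< N (λ t → χ (P? t)) ℕ.+_) (sym (χ-no (P? N) np))) (sym (Σ-last N (λ t → χ (P? t))))))

    witnesses-sound : ∀ N → All (λ t → P t × t ℕ.< N) (witnesses N)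
    witnesses-sound zero = []
    witnesses-sound (suc N) with P? N
    ... | yes p = (p , ℕP.≤-refl) ∷ All.map (λ {(pt , lt) → pt , ℕP.m<n⇒m<1+n lt}) (witnesses-sound N)
    ... | no _ = All.map (λ {(pt , lt) → pt , ℕP.m<n⇒m<1+n lt}) (witnesses-sound N)

    witnesses-distinct : ∀ N → AllPairs (λ a b → ¬ a ≡ b) (witnesses N)
    witnesses-distinct zero = []
    witnesses-distinct (suc N) with P? N
    ... | yes p = All.map (λ {(pt , lt) e → ℕP.<-irrefl (sym e) lt}) (witnesses-sound N) ∷ witnesses-distinct N
    ... | no _ = witnesses-distinct N

  count-upper : ∀ {q} → Prime q → ∀ m f → Monic m f → (P? : ∀ t → Dec ((+ q) ∣ f (+ t))) →
    Σ< q (λ t → χ (P? t)) ℕ.≤ m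
  count-upper {q} pq m f mf P? = subst (ℕ._≤ m) (trans (length-map +_ (witnesses q)) (witnesses-length q))
     (rootBound pq m f mf (map +_ (witnesses q)) (roots-of-witnesses (witnesses-sound q)) (incongruent-witnesses (witnesses-sound q) (witnesses-distinct q)))
    where
    open Witnesses P?

    roots-of-witnesses : ∀ {xs} → All (λ t → (+ q) ∣ f (+ t) × t ℕ.< q) xs → All (λ r → (+ q) ∣ f r) (map +_ xs)
    roots-of-witnesses [] = []
    roots-of-witnesses ((p , _) ∷ ps) = p ∷ roots-of-witnesses ps
    incongruent-witnesses : ∀ {xs} → All (λ t → (+ q) ∣ f (+ t) × t ℕ.< q) xs → AllPairs (λ a b → ¬ a ≡ b) xs →
               AllPairs (λ a b → ¬ Cg (+ q) a b) (map +_ xs)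
    incongruent-witnesses [] [] = []
    incongruent-witnesses {x ∷ xs} ((_ , x<q) ∷ ps) (h ∷ hs) = from-x ps h ∷ incongruent-witnesses ps hs
      where
      from-x : ∀ {ys} → All (λ t → (+ q) ∣ f (+ t) × t ℕ.< q) ys → All (λ b → ¬ x ≡ b) ys → All (λ b → ¬ Cg (+ q) (+ x) b) (map +_ ys)
      from-x [] [] = []
      from-x ((_ , y<q) ∷ ps) (n ∷ ns) = (λ c → n (resid-eq x _ x<q y<q c)) ∷ from-x ps ns

module RootsModPrime where

  -- For odd p, primes q and τ = ±1: exactly gcd(p, q - 1) residues t < q
  -- satisfy t ^ p ≡ τ (mod q).
  --  * If p ∤ q - 1 then p is invertible mod q - 1, so x ↦ x ^ p is injective
  --    on units (Bézout + Fermat) and τ is the only root.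
  --  * If p ∣ q - 1, write q - 1 = e p.  Lagrange bounds the roots of x ^ e - 1
  --    by e < q - 1, so some a has b = a ^ e ≢ 1; then b ^ p ≡ 1 and the p
  --    residues τ b ^ i (i < p) are distinct roots, which Lagrange shows are all.

  open FiniteSums
  open Valuation using (prime≥2; prime≥1)
  open Congruence
  open RootCounting
  open import Data.Integer hiding (suc; pred)
  open import Data.Integer.Properties
  open import Data.Integer.Divisibility.Signed
  open import Data.Integer.Tactic.RingSolver
  import Data.Integer.DivMod as ZDM
  open import Data.Nat as ℕ using (ℕ; zero; suc)
  import Data.Nat.Properties as ℕP
  import Data.Nat.Divisibility as ℕD
  open import Data.Nat.Primality
  open import Data.Nat.GCD using (gcd; gcd[m,n]∣m; gcd[m,n]∣n; gcd-greatest)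
  open import Data.Nat.Coprimality using (gcd≡1⇒coprime; prime⇒coprime)
  import Data.Nat.Coprimality as Coprimality
  open import Data.Product
  open import Data.Sum
  open import Data.Empty
  open import Relation.Nullary
  open import Relation.Nullary.Decidable using (¬?; decidable-stable)
  open import Relation.Binary.PropositionalEquality
  open import Relation.Binary.Definitions using (tri<; tri≈; tri>)

  -- τ = ±1, the constant term of Q(x) = x ^ p - τ.
  IsSign : ℤ → Set
  IsSign τ = τ ≡ 1ℤ ⊎ τ ≡ -1ℤ

  -1^odd : ∀ n → ¬ (2 ℕD.∣ n) → -1ℤ ^ n ≡ -1ℤ
  -1^odd zero odd = ⊥-elim (odd (ℕD.divides 0 refl))
  -1^odd (suc zero) odd = refl
  -1^odd (suc (suc n)) odd =
    trans (sym (*-assoc -1ℤ -1ℤ (-1ℤ ^ n))) (trans (*-identityˡ (-1ℤ ^ n)) (-1^odd n (λ 2∣n → odd (ℕD.∣m∣n⇒∣m+n (ℕD.divides 1 refl) 2∣n))))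

  sign-pow : ∀ {τ} → IsSign τ → ∀ p → ¬ (2 ℕD.∣ p) → τ ^ p ≡ τ
  sign-pow (inj₁ refl) p _ = ^-zeroˡ p
  sign-pow (inj₂ refl) p odd = -1^odd p odd

  sign-sq : ∀ {τ} → IsSign τ → τ * τ ≡ 1ℤ
  sign-sq (inj₁ refl) = refl
  sign-sq (inj₂ refl) = refl

  prime∤sign : ∀ {q} → Prime q → ∀ {τ} → IsSign τ → ¬ ((+ q) ∣ τ)
  prime∤sign pq (inj₁ refl) = ¬∣1 pq
  prime∤sign pq (inj₂ refl) = ¬∣-1 pq

  *-pow : ∀ a b n → (a * b) ^ n ≡ a ^ n * b ^ n
  *-pow a b zero = refl
  *-pow a b (suc n) = trans (cong ((a * b) *_) (*-pow a b n)) (interchange a b (a ^ n) (b ^ n))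
    where interchange : ∀ a b A B → (a * b) * (A * B) ≡ (a * A) * (b * B)
          interchange = solve-∀

  sign-residue : ∀ q → 2 ℕ.≤ q → ∀ {τ} → IsSign τ → Σ ℕ (λ t₀ → t₀ ℕ.< q × Cg (+ q) (+ t₀) τ)
  sign-residue q q≥2 (inj₁ refl) = 1 , q≥2 , Cg-refl _ 1ℤ
  sign-residue (suc q') q≥2 (inj₂ refl) = q' , ℕP.n<1+n q' ,
      cg (divides 1ℤ (trans (sym (pos-+ q' 1)) (trans (cong +_ (ℕP.+-comm q' 1)) (sym (*-identityˡ (+ suc q'))))))

  Hit : (q p : ℕ) (τ : ℤ) → ℕ → ℕ → ℕ
  Hit q p τ j x = χ (dec∣ (+ (q ℕ.^ j)) ((+ x) ^ p - τ))

  module RootCount (q p : ℕ) (pq : Prime q) (pp : Prime p) (odd : ¬ (2 ℕD.∣ p)) (τ : ℤ) (τ± : IsSign τ) where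

    q≥1 : 1 ℕ.≤ q
    q≥1 = prime≥1 pq
    p≥1 : 1 ℕ.≤ p
    p≥1 = prime≥1 pp

    Root? : ∀ t → Dec ((+ q) ∣ (+ t) ^ p - τ)
    Root? t = dec∣ (+ q) ((+ t) ^ p - τ)

    unit : ∀ x → x ℕ.< q → x ℕ.≥ 1 → ¬ ((+ q) ∣ (+ x))
    unit x x<q x≥1 d = ℕP.<-irrefl refl (ℕP.≤-trans x<q (ℕD.∣⇒≤ {{ℕ.>-nonZero x≥1}} (∣⇒∣ᵤ d)))

    unτ : ∀ {u v} → Cg (+ q) (τ * u) (τ * v) → Cg (+ q) u v
    unτ {u} {v} c = subst₂ (Cg (+ q)) (ττu u) (ττu v) (Cg-* (Cg-refl _ τ) c)
      where ττu : ∀ u → τ * (τ * u) ≡ u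
            ττu u = trans (sym (*-assoc τ τ u)) (trans (cong (_* u) (sign-sq τ±)) (*-identityˡ u))

    module Coprime-case (p∤q-1 : ¬ (p ℕD.∣ (q ℕ.∸ 1))) where

      g≡1 : gcd p (q ℕ.∸ 1) ≡ 1
      g≡1 with prime⇒irreducible pp (gcd[m,n]∣m p (q ℕ.∸ 1))
      ... | inj₁ e = e
      ... | inj₂ e = ⊥-elim (p∤q-1 (subst (ℕD._∣ (q ℕ.∸ 1)) e (gcd[m,n]∣n p (q ℕ.∸ 1))))

      -- x ^ p ≡ τ forces x ≡ τ: y = τ x satisfies y ^ p ≡ 1 and y ^ (q - 1) ≡ 1.
      root-is-τ : ∀ x → Cg (+ q) (x ^ p) τ → Cg (+ q) x τ
      root-is-τ x c = unτ (Cg-trans y≡1 (Cg-reflexive _ (sym (sign-sq τ±))))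
        where
        y : ℤ
        y = τ * x
        yᵖ≡1 : Cg (+ q) (y ^ p) 1ℤ
        yᵖ≡1 = Cg-trans (Cg-reflexive _ (trans (*-pow τ x p) (cong (_* x ^ p) (sign-pow τ± p odd))))
                       (Cg-trans (Cg-* (Cg-refl _ τ) c) (Cg-reflexive _ (sign-sq τ±)))
        q∤y : ¬ ((+ q) ∣ y)
        q∤y d = ¬∣1 pq (Cg-dvd (Cg-sym yᵖ≡1) (∣pow y p p≥1 d))
        y≡1 : Cg (+ q) y 1ℤ
        y≡1 = bezout-pow p (q ℕ.∸ 1) (gcd≡1⇒coprime g≡1) y yᵖ≡1 (fermat' pq y q∤y)

      count : Σ< q (λ t → χ (Root? t)) ≡ gcd p (q ℕ.∸ 1)
      count with sign-residue q (prime≥2 pq) τ±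
      ... | t₀ , t₀<q , t₀≡τ = trans (count1 q Root? t₀ uniq t₀<q t₀-root) (sym g≡1)
        where
        t₀-root : (+ q) ∣ (+ t₀) ^ p - τ
        t₀-root = getCg (Cg-trans (Cg-pow p t₀≡τ) (Cg-reflexive _ (sign-pow τ± p odd)))
        uniq : ∀ t → t ℕ.< q → (+ q) ∣ (+ t) ^ p - τ → t ≡ t₀
        uniq t t<q d = resid-eq t t₀ t<q t₀<q (Cg-trans (root-is-τ (+ t) (cg d)) (Cg-sym t₀≡τ))

    module Divisible-case (p∣q-1 : p ℕD.∣ (q ℕ.∸ 1)) where

      g≡p : gcd p (q ℕ.∸ 1) ≡ p
      g≡p = ℕD.∣-antisym (gcd[m,n]∣m p (q ℕ.∸ 1)) (gcd-greatest ℕD.∣-refl p∣q-1)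

      e : ℕ
      e = ℕD.quotient p∣q-1

      q-1≡ep : q ℕ.∸ 1 ≡ e ℕ.* p
      q-1≡ep = ℕD._∣_.equality p∣q-1

      q-1+1≡q : q ℕ.∸ 1 ℕ.+ 1 ≡ q
      q-1+1≡q = ℕP.m∸n+n≡m q≥1

      e≥1 : 1 ℕ.≤ e
      e≥1 = ℕP.n≢0⇒n>0 (λ e≡0 → ℕP.<-irrefl refl (ℕP.≤-trans (ℕP.∸-monoˡ-≤ 1 (prime≥2 pq))
                                                   (ℕP.≤-reflexive (trans q-1≡ep (cong (ℕ._* p) e≡0)))))

      e<q-1 : e ℕ.< q ℕ.∸ 1
      e<q-1 = begin-strict
        e                ≡⟨ sym (ℕP.*-identityʳ e) ⟩
        e ℕ.* 1          <⟨ ℕP.*-monoʳ-< e {{ℕ.>-nonZero e≥1}} (prime≥2 pp) ⟩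
        e ℕ.* p          ≡⟨ sym q-1≡ep ⟩
        q ℕ.∸ 1          ∎
        where open ℕP.≤-Reasoning

      -- Some 1 ≤ a < q is not a root of x ^ e - 1 mod q: otherwise the q - 1
      -- units would be roots, exceeding Lagrange's bound e.
      NonRoot : ℕ → Set
      NonRoot i = ¬ ((+ q) ∣ (+ suc i) ^ e - 1ℤ)

      nonroot : Σ ℕ (λ i → i ℕ.< q ℕ.∸ 1 × NonRoot i)
      nonroot with ℕP.anyUpTo? (λ i → ¬? (dec∣ (+ q) ((+ suc i) ^ e - 1ℤ))) (q ℕ.∸ 1)
      ... | yes found = found
      ... | no none = ⊥-elim (ℕP.<⇒≱ e<q-1 (ℕP.≤-trans all-roots (count-upper pq e (λ x → x ^ e - 1ℤ) (Monic-pow' e e≥1 -1ℤ) Root'?)))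
        where
        Root'? : ∀ t → Dec ((+ q) ∣ (+ t) ^ e - 1ℤ)
        Root'? t = dec∣ (+ q) ((+ t) ^ e - 1ℤ)
        all-roots : q ℕ.∸ 1 ℕ.≤ Σ< q (λ t → χ (Root'? t))
        all-roots = count-lower q Root'? (q ℕ.∸ 1) suc
          (λ i i< → ℕP.≤-trans (ℕ.s≤s i<) (ℕP.≤-reflexive (trans (ℕP.+-comm 1 (q ℕ.∸ 1)) q-1+1≡q)))
          (λ i i< → decidable-stable (Root'? (suc i)) (λ ¬root → none (i , i< , ¬root)))
          (λ i i' _ _ → ℕP.suc-injective)

      a : ℕ
      a = suc (proj₁ nonroot)

      b : ℤ
      b = (+ a) ^ e

      b≢1 : ¬ Cg (+ q) b 1ℤ
      b≢1 c = proj₂ (proj₂ nonroot) (getCg c)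

      bᵖ≡1 : Cg (+ q) (b ^ p) 1ℤ
      bᵖ≡1 = subst (λ z → Cg (+ q) z 1ℤ) (sym (trans (^-*-assoc (+ a) e p) (cong ((+ a) ^_) (sym q-1≡ep))))
               (fermat' pq (+ a) (unit a (ℕP.≤-trans (ℕ.s≤s (proj₁ (proj₂ nonroot))) (ℕP.≤-reflexive (trans (ℕP.+-comm 1 _) q-1+1≡q))) (ℕ.s≤s ℕ.z≤n)))

      q∤b : ¬ ((+ q) ∣ b)
      q∤b d = ¬∣1 pq (Cg-dvd (Cg-sym bᵖ≡1) (∣pow b p p≥1 d))

      bpow-distinct : ∀ i d → 1 ℕ.≤ d → d ℕ.< p → ¬ Cg (+ q) (b ^ i) (b ^ (i ℕ.+ d))
      bpow-distinct i d d≥1 d<p c =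
        [ (λ q∣bⁱ → q∤b (prime∣pow pq b i q∣bⁱ))
        , (λ q∣bᵈ-1 → b≢1 (bezout-pow d p (Coprimality.sym (prime⇒coprime pp {{ℕ.>-nonZero d≥1}} d<p)) b (cg q∣bᵈ-1) bᵖ≡1)) ]′
        (euclidℤ pq (b ^ i) (b ^ d - 1ℤ) (subst ((+ q) ∣_) (factor (b ^ i) (b ^ d)) (getCg (Cg-sym (subst (Cg (+ q) (b ^ i)) (^-distribˡ-+-* b i d) c)))))
        where factor : ∀ X D → X * D - X ≡ X * (D - 1ℤ)
              factor = solve-∀

      ρ : ℕ → ℕ
      ρ i = ZDM._%_ (τ * b ^ i) (+ q) {{nzpos q q≥1}}

      ρ≡ : ∀ i → Cg (+ q) (+ ρ i) (τ * b ^ i)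
      ρ≡ i = cg-mod q q≥1 (τ * b ^ i)

      ρ<q : ∀ i → ρ i ℕ.< q
      ρ<q i = ZDM.n%d<d (τ * b ^ i) (+ q) {{nzpos q q≥1}}

      ρ-root : ∀ i → (+ q) ∣ (+ ρ i) ^ p - τ
      ρ-root i = getCg (Cg-trans (Cg-pow p (ρ≡ i)) (Cg-trans (Cg-reflexive _ expand)
                   (Cg-trans (Cg-* (Cg-refl _ τ) bᵖⁱ≡1) (Cg-reflexive _ (*-identityʳ τ)))))
        where
        expand : (τ * b ^ i) ^ p ≡ τ * (b ^ p) ^ i
        expand = trans (*-pow τ (b ^ i) p) (cong₂ _*_ (sign-pow τ± p odd)
                   (trans (^-*-assoc b i p) (trans (cong (b ^_) (ℕP.*-comm i p)) (sym (^-*-assoc b p i)))))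
        bᵖⁱ≡1 : Cg (+ q) ((b ^ p) ^ i) 1ℤ
        bᵖⁱ≡1 = subst (Cg (+ q) ((b ^ p) ^ i)) (^-zeroˡ i) (Cg-pow i bᵖ≡1)

      ρ-ordered : ∀ i i' → i ℕ.< i' → i' ℕ.< p → ρ i ≢ ρ i'
      ρ-ordered i i' i<i' i'<p eq = bpow-distinct i (i' ℕ.∸ i) (ℕP.m<n⇒0<n∸m i<i') (ℕP.≤-trans (ℕ.s≤s (ℕP.m∸n≤m i' i)) i'<p)
        (subst (Cg (+ q) (b ^ i)) (cong (b ^_) (sym (ℕP.m+[n∸m]≡n (ℕP.<⇒≤ i<i'))))
          (unτ (Cg-trans (Cg-sym (ρ≡ i)) (Cg-trans (Cg-reflexive _ (cong +_ eq)) (ρ≡ i')))))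

      ρ-injective : ∀ i i' → i ℕ.< p → i' ℕ.< p → ρ i ≡ ρ i' → i ≡ i'
      ρ-injective i i' i<p i'<p eq with ℕP.<-cmp i i'
      ... | tri≈ _ i≡i' _ = i≡i'
      ... | tri< i<i' _ _ = ⊥-elim (ρ-ordered i i' i<i' i'<p eq)
      ... | tri> _ _ i'<i = ⊥-elim (ρ-ordered i' i i'<i i<p (sym eq))

      count : Σ< q (λ t → χ (Root? t)) ≡ gcd p (q ℕ.∸ 1)
      count = trans (ℕP.≤-antisym (count-upper pq p (λ x → x ^ p - τ) (Monic-pow' p p≥1 (- τ)) Root?)
                                  (count-lower q Root? p ρ (λ i _ → ρ<q i) (λ i _ → ρ-root i) ρ-injective))
                    (sym g≡p)

    root-count : Σ< q (λ t → χ (Root? t)) ≡ gcd p (q ℕ.∸ 1)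
    root-count with p ℕD.∣? (q ℕ.∸ 1)
    ... | yes p∣q-1 = Divisible-case.count p∣q-1
    ... | no p∤q-1 = Coprime-case.count p∤q-1

module Hensel where

  -- Hensel lifting for q ≠ p.  Write x' = x + t q^(j+1) (t < q).  Modulo
  -- q^(j+2), Q(x') ≡ Q(x) + t q^(j+1) · p x^(p-1), and p x^(p-1) is a unit mod
  -- q when x is a root; so a root x mod q^(j+1) has exactly one lift mod
  -- q^(j+2), and a non-root has none.  Hence the number of roots of
  -- x ^ p ≡ τ mod q^j is the same for every j ≥ 1, namely gcd(p, q - 1).

  open FiniteSums
  open Valuation using (prime≥2; prime≥1)
  open Congruence
  open RootCounting using (resid-eq)
  open RootsModPrime
  open import Data.Integer hiding (suc; pred)
  open import Data.Integer.Properties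
  open import Data.Integer.Divisibility.Signed
  open import Data.Integer.Tactic.RingSolver
  import Data.Integer.DivMod as ZDM
  open import Data.Nat as ℕ using (ℕ; zero; suc)
  import Data.Nat.Properties as ℕP
  import Data.Nat.Divisibility as ℕD
  open import Data.Nat.Primality
  open import Data.Nat.GCD using (gcd)
  open import Data.Product using (Σ; _×_; _,_)
  open import Data.Sum using (inj₁; inj₂; [_,_]′)
  open import Data.Empty
  open import Relation.Nullary
  open import Relation.Binary.PropositionalEquality

  binomial-linear : ∀ k x h → Σ ℤ λ R → (x + h) ^ suc k ≡ x ^ suc k + (+ suc k) * x ^ k * h + h * h * R
  binomial-linear zero x h = 0ℤ , base x h
    where base : ∀ x h → (x + h) * 1ℤ ≡ x * 1ℤ + + 1 * 1ℤ * h + h * h * 0ℤ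
          base = solve-∀
  binomial-linear (suc k) x h with binomial-linear k x h
  ... | R , e = (x * R + (+ suc k) * x ^ k + h * R) , trans (cong ((x + h) *_) e)
        (trans (step x h R (x ^ k) (+ suc k))
               (cong (λ z → x * (x * x ^ k) + z * (x * x ^ k) * h + h * h * (x * R + (+ suc k) * x ^ k + h * R))
                     (sym (trans (cong +_ (ℕP.+-comm 1 (suc k))) (pos-+ (suc k) 1)))))
    where step : ∀ x h R X K → (x + h) * (x * X + K * X * h + h * h * R)
                               ≡ x * (x * X) + (K + + 1) * (x * X) * h + h * h * (x * R + K * X + h * R)
          step = solve-∀

  module Lifting (q p : ℕ) (pq : Prime q) (pp : Prime p) (q≢p : q ≢ p) (odd : ¬ (2 ℕD.∣ p))
                 (τ : ℤ) (τ± : IsSign τ) where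

    Qz : ℤ → ℤ
    Qz x = x ^ p - τ

    hit : ℕ → ℕ → ℕ
    hit = Hit q p τ

    q≥1 : 1 ℕ.≤ q
    q≥1 = prime≥1 pq
    p≥1 : 1 ℕ.≤ p
    p≥1 = prime≥1 pp

    Q : ℤ
    Q = + q

    -- q ∤ p since q ≠ p are primes: the derivative p x ^ (p - 1) has no factor q.
    q∤p : ¬ (Q ∣ + p)
    q∤p d with prime⇒irreducible pp (∣⇒∣ᵤ d)
    ... | inj₁ q≡1 = ℕP.<-irrefl refl (ℕP.≤-trans (prime≥2 pq) (ℕP.≤-reflexive q≡1))
    ... | inj₂ q≡p = q≢p q≡p

    hit-periodic : ∀ j x → hit j (x ℕ.+ q ℕ.^ j) ≡ hit j x
    hit-periodic j x = χ-cong (dec∣ M (Qz (+ (x ℕ.+ q ℕ.^ j)))) (dec∣ M (Qz (+ x)))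
       (Cg-dvd (Cg-sym Q≡)) (Cg-dvd Q≡)
      where
      M : ℤ
      M = + (q ℕ.^ j)
      shift : ∀ a b → a + b - a ≡ 1ℤ * b
      shift = solve-∀
      x≡ : Cg M (+ (x ℕ.+ q ℕ.^ j)) (+ x)
      x≡ = cg (divides 1ℤ (trans (cong (_- + x) (pos-+ x (q ℕ.^ j))) (shift (+ x) M)))
      Q≡ : Cg M (Qz (+ (x ℕ.+ q ℕ.^ j))) (Qz (+ x))
      Q≡ = Cg-+ (Cg-pow p x≡) (Cg-refl M (- τ))

    module Lifts (j : ℕ) (x : ℕ) where
      N : ℤ
      N = + (q ℕ.^ j)
      M : ℕ
      M = q ℕ.^ suc j
      X : ℤ
      X = + x
      M≡ : + M ≡ Q * N
      M≡ = pos-* q (q ℕ.^ j)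
      qM≡ : + (q ℕ.^ suc (suc j)) ≡ (Q * N) * Q
      qM≡ = trans (pos-* q M) (trans (cong (Q *_) M≡) (*-comm Q (Q * N)))

      k : ℕ
      k = p ℕ.∸ 1
      k+1≡p : suc k ≡ p
      k+1≡p = trans (ℕP.+-comm 1 k) (ℕP.m∸n+n≡m p≥1)

      -- the derivative Q'(x) = p x ^ (p - 1)
      u : ℤ
      u = + p * X ^ k

      lift : ℕ → ℤ
      lift t = + (x ℕ.+ t ℕ.* M)

      lift≡ : ∀ t → lift t ≡ X + + t * (Q * N)
      lift≡ t = trans (pos-+ x (t ℕ.* M)) (cong (λ z → X + z) (trans (pos-* t M) (cong (+ t *_) M≡)))

      taylor : ∀ t → Σ ℤ λ R → Qz (lift t) ≡ Qz X + u * + t * (Q * N) + (+ t * (Q * N)) * (+ t * (Q * N)) * R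
      taylor t with binomial-linear k X (+ t * (Q * N))
      ... | R , e = R , (begin
        Qz (lift t)                                                    ≡⟨ cong Qz (lift≡ t) ⟩
        (X + h) ^ p - τ                                                ≡⟨ cong (λ z → (X + h) ^ z - τ) (sym k+1≡p) ⟩
        (X + h) ^ suc k - τ                                            ≡⟨ cong (_- τ) e ⟩
        X ^ suc k + (+ suc k) * X ^ k * h + h * h * R - τ              ≡⟨ cong (λ z → X ^ z + (+ z) * X ^ k * h + h * h * R - τ) k+1≡p ⟩
        X ^ p + (+ p) * X ^ k * h + h * h * R - τ                      ≡⟨ regroup (X ^ p) (+ p) (X ^ k) (+ t) (Q * N) R τ ⟩
        Qz X + u * + t * (Q * N) + h * h * R                           ∎)
        where
        open ≡-Reasoning
        h = + t * (Q * N)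
        regroup : ∀ A P K T M R τ → A + P * K * (T * M) + (T * M) * (T * M) * R - τ ≡ (A - τ) + P * K * T * M + (T * M) * (T * M) * R
        regroup = solve-∀

      no-lift : ¬ (+ M ∣ Qz X) → ∀ t → ¬ (+ (q ℕ.^ suc (suc j)) ∣ Qz (lift t))
      no-lift M∤ t d with taylor t
      ... | R , e = M∤ (subst (_∣ Qz X) (sym M≡) (∣m+n∣n⇒∣m (subst (Q * N ∣_) (regroup (Qz X) u (+ t) (Q * N) R) (subst (Q * N ∣_) e M∣lift)) (∣m⇒∣m*n _ ∣-refl)))
        where
        M∣lift : (Q * N) ∣ Qz (lift t)
        M∣lift = ∣-trans (divides Q (trans qM≡ (*-comm (Q * N) Q))) d
        regroup : ∀ A u T M R → A + u * T * M + (T * M) * (T * M) * R ≡ A + M * (u * T + T * T * M * R)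
        regroup = solve-∀

      module Root (c : ℤ) (Qx≡ : Qz X ≡ c * + M) where

        reduced : ∀ t → Σ ℤ λ S → Qz (lift t) ≡ (Q * N) * ((c + u * + t) + Q * S)
        reduced t with taylor t
        ... | R , e = (+ t * + t * N * R) , trans e (trans (cong (λ z → z + u * + t * (Q * N) + (+ t * (Q * N)) * (+ t * (Q * N)) * R) (trans Qx≡ (cong (c *_) M≡))) (regroup c u (+ t) Q N R))
          where regroup : ∀ c u T Q N R → c * (Q * N) + u * T * (Q * N) + (T * (Q * N)) * (T * (Q * N)) * R ≡ (Q * N) * ((c + u * T) + Q * (T * T * N * R))
                regroup = solve-∀

        lift-root⇒ : ∀ t → + (q ℕ.^ suc (suc j)) ∣ Qz (lift t) → Q ∣ c + u * + t
        lift-root⇒ t d with reduced t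
        ... | S , e = ∣m+n∣n⇒∣m (*-cancelˡ-∣ (Q * N) {{QN≢0}} (subst₂ _∣_ qM≡ e d)) (∣m⇒∣m*n S ∣-refl)
          where QN≢0 : NonZero (Q * N)
                QN≢0 = subst NonZero M≡ (nzpos M (ℕP.m^n>0 q {{ℕ.>-nonZero q≥1}} (suc j)))

        lift-root⇐ : ∀ t → Q ∣ c + u * + t → + (q ℕ.^ suc (suc j)) ∣ Qz (lift t)
        lift-root⇐ t d with reduced t
        ... | S , e = subst₂ _∣_ (sym qM≡) (sym e) (*-monoʳ-∣ (Q * N) (∣m∣n⇒∣m+n d (∣m⇒∣m*n S ∣-refl)))

        -- x is a unit mod q (since τ is), hence so is the derivative u.
        q∤x : ¬ (Q ∣ X)
        q∤x d = prime∤sign pq τ± (subst (Q ∣_) (neg-involutive τ) (∣m⇒∣-m (∣m+n∣m⇒∣n q∣Qx (∣pow X p p≥1 d))))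
          where q∣Qx : Q ∣ X ^ p + - τ
                q∣Qx = ∣-trans (divides N (trans M≡ (*-comm Q N))) (subst (+ M ∣_) (sym Qx≡) (∣n⇒∣m*n c ∣-refl))

        q∤u : ¬ (Q ∣ u)
        q∤u d = [ q∤p , (λ d' → q∤x (prime∣pow pq X k d')) ]′ (euclidℤ pq (+ p) (X ^ k) d)

        -- the inverse w of u mod q, and the unique solution t₀ ≡ - c w
        w : ℤ
        w = u ^ (q ℕ.∸ 2)
        uw≡1 : Cg Q (u * w) 1ℤ
        uw≡1 = subst (λ z → Cg Q z 1ℤ) (cong (u ^_) (q-1≡ q (prime≥2 pq))) (fermat' pq u q∤u)
          where q-1≡ : ∀ q → 2 ℕ.≤ q → q ℕ.∸ 1 ≡ suc (q ℕ.∸ 2)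
                q-1≡ (suc (suc q)) _ = refl
                q-1≡ (suc zero) (ℕ.s≤s ())

        t₀ : ℕ
        t₀ = ZDM._%_ (- c * w) Q {{nzpos q q≥1}}
        t₀<q : t₀ ℕ.< q
        t₀<q = ZDM.n%d<d (- c * w) Q {{nzpos q q≥1}}

        t₀-solves : Q ∣ c + u * + t₀
        t₀-solves = Cg-0' (Cg-trans (Cg-+ (Cg-refl Q c) (Cg-* (Cg-refl Q u) (cg-mod q q≥1 (- c * w))))
                      (Cg-trans (Cg-reflexive Q (regroup c u w)) (Cg-trans (Cg-+ (Cg-refl Q c) (Cg-* (Cg-refl Q (- c)) uw≡1)) (Cg-reflexive Q (cancel c)))))
          where regroup : ∀ c u w → c + u * (- c * w) ≡ c + - c * (u * w)
                regroup = solve-∀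
                cancel : ∀ c → c + - c * 1ℤ ≡ 0ℤ
                cancel = solve-∀

        t₀-unique : ∀ t → t ℕ.< q → + (q ℕ.^ suc (suc j)) ∣ Qz (lift t) → t ≡ t₀
        t₀-unique t t<q d = resid-eq t t₀ t<q t₀<q (cg ([ (λ q∣u → ⊥-elim (q∤u q∣u)) , (λ q∣t-t₀ → q∣t-t₀) ]′
            (euclidℤ pq u (+ t - + t₀) (subst (Q ∣_) (difference c u (+ t) (+ t₀)) (∣m∣n⇒∣m-n (lift-root⇒ t d) t₀-solves)))))
          where difference : ∀ c u t t₀ → (c + u * t) - (c + u * t₀) ≡ u * (t - t₀)
                difference = solve-∀

      lift-count : Σ< q (λ t → hit (suc (suc j)) (x ℕ.+ t ℕ.* M)) ≡ hit (suc j) x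
      lift-count with dec∣ (+ M) (Qz X)
      ... | no M∤ = count0 q (λ t → dec∣ (+ (q ℕ.^ suc (suc j))) (Qz (lift t))) (λ t _ → no-lift M∤ t)
      ... | yes (divides c Qx≡) = count1 q (λ t → dec∣ (+ (q ℕ.^ suc (suc j))) (Qz (lift t))) t₀ t₀-unique t₀<q (lift-root⇐ t₀ t₀-solves)
        where open Root c Qx≡

    roots : ℕ → ℕ
    roots j = Σ< (q ℕ.^ j) (hit j)

    -- Splitting [0, q^(j+2)) into q blocks of length q^(j+1) and lifting:
    -- the root count does not change from level j+1 to level j+2.
    roots-step : ∀ j → roots (suc (suc j)) ≡ roots (suc j)
    roots-step j = begin
      Σ< (q ℕ.* M) (hit (suc (suc j)))                                        ≡⟨ Σ-blocks q M _ ⟩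
      Σ< q (λ t → Σ< M (λ x → hit (suc (suc j)) (t ℕ.* M ℕ.+ x)))             ≡⟨ Σ-swap q M _ ⟩
      Σ< M (λ x → Σ< q (λ t → hit (suc (suc j)) (t ℕ.* M ℕ.+ x)))             ≡⟨ Σ-ext M (λ x → trans (Σ-ext q (λ t → cong (hit (suc (suc j))) (ℕP.+-comm (t ℕ.* M) x)))
                                                                                                       (Lifts.lift-count j x)) ⟩
      Σ< M (hit (suc j))                                                      ∎
      where open ≡-Reasoning
            M = q ℕ.^ suc j

    roots-one : roots 1 ≡ gcd p (q ℕ.∸ 1)
    roots-one = trans (cong (λ z → Σ< z (hit 1)) (ℕP.*-identityʳ q))
      (trans (Σ-ext q (λ t → χ-cong (dec∣ (+ (q ℕ.^ 1)) (Qz (+ t))) (RootCount.Root? q p pq pp odd τ τ± t)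
                               (subst (_∣ Qz (+ t)) q¹≡q) (subst (_∣ Qz (+ t)) (sym q¹≡q))))
             (RootCount.root-count q p pq pp odd τ τ±))
      where q¹≡q = cong +_ (ℕP.*-identityʳ q)

    roots-all : ∀ j → roots (suc j) ≡ gcd p (q ℕ.∸ 1)
    roots-all zero = roots-one
    roots-all (suc j) = trans (roots-step j) (roots-all j)

module LiftingTheExponent where

  -- For τ = 1 and x = 1 + p m one has x ^ p - 1 = (x - 1) W with
  -- W = 1 + x + … + x ^ (p-1) ≡ p (mod p²), i.e. W = p w with p ∤ w;
  -- τ = -1 reduces to τ = 1 through x ↦ -x since p is odd.
  -- Consequently the roots of x ^ p ≡ τ mod p ^ (j+1) form one residue class
  -- modulo p ^ max(j, 1), which is what the p-adic count needs.

  open import Defs using (ν)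
  open FiniteSums
  open Valuation
  open Congruence
  open RootCounting using (resid-eq)
  open RootsModPrime using (IsSign; Hit; -1^odd; *-pow)
  open import Data.Integer hiding (suc; pred)
  open import Data.Integer.Properties
  open import Data.Integer.Divisibility.Signed
  open import Data.Integer.Tactic.RingSolver
  import Data.Integer.DivMod as ZDM
  open import Data.Nat as ℕ using (ℕ; zero; suc)
  import Data.Nat.Properties as ℕP
  import Data.Nat.Divisibility as ℕD
  open import Data.Nat.Primality
  open import Data.Product using (Σ; _×_; _,_; proj₁; proj₂)
  open import Data.Sum using (inj₁; inj₂)
  open import Data.Empty
  open import Relation.Nullary
  open import Relation.Binary.PropositionalEquality
  import Data.Nat.Tactic.RingSolver as ℕ-Solver

  T : ℕ → ℕ
  T zero = 0
  T (suc k) = T k ℕ.+ k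

  -- In particular p ∣ T p for odd p.
  T-odd : ∀ h → T (suc (2 ℕ.* h)) ≡ suc (2 ℕ.* h) ℕ.* h
  T-odd zero = refl
  T-odd (suc h) = begin
    T (suc (2 ℕ.* suc h))                                                    ≡⟨ cong (λ z → T (suc z)) (ℕP.*-suc 2 h) ⟩
    T (suc (2 ℕ.* h)) ℕ.+ suc (2 ℕ.* h) ℕ.+ suc (suc (2 ℕ.* h))              ≡⟨ cong (λ z → z ℕ.+ suc (2 ℕ.* h) ℕ.+ suc (suc (2 ℕ.* h))) (T-odd h) ⟩
    suc (2 ℕ.* h) ℕ.* h ℕ.+ suc (2 ℕ.* h) ℕ.+ suc (suc (2 ℕ.* h))            ≡⟨ step h ⟩
    suc (2 ℕ.* suc h) ℕ.* suc h                                              ∎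
    where open ≡-Reasoning
          step : ∀ h → suc (2 ℕ.* h) ℕ.* h ℕ.+ suc (2 ℕ.* h) ℕ.+ suc (suc (2 ℕ.* h)) ≡ suc (2 ℕ.* suc h) ℕ.* suc h
          step = ℕ-Solver.solve-∀

  odd-form : ∀ p → ¬ (2 ℕD.∣ p) → Σ ℕ λ h → p ≡ suc (2 ℕ.* h)
  odd-form zero odd = ⊥-elim (odd (ℕD.divides 0 refl))
  odd-form (suc zero) odd = 0 , refl
  odd-form (suc (suc p)) odd with odd-form p (λ 2∣p → odd (ℕD.∣m∣n⇒∣m+n (ℕD.divides 1 refl) 2∣p))
  ... | h , p≡ = suc h , trans (cong (λ z → suc (suc z)) p≡) (step h)
    where step : ∀ h → suc (suc (suc (2 ℕ.* h))) ≡ suc (2 ℕ.* suc h)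
          step = ℕ-Solver.solve-∀

  InClass : ℕ → ℤ → ℕ → ℕ
  InClass d τ k = χ (dec∣ (+ d) (+ k - τ))

  InClass-periodic : ∀ d τ i → InClass d τ (i ℕ.+ d) ≡ InClass d τ i
  InClass-periodic d τ i = χ-cong (dec∣ (+ d) (+ (i ℕ.+ d) - τ)) (dec∣ (+ d) (+ i - τ))
    (λ h → ∣m+n∣n⇒∣m (subst (+ d ∣_) shift h) ∣-refl) (λ h → subst (+ d ∣_) (sym shift) (∣m∣n⇒∣m+n h ∣-refl))
    where
    rearrange : ∀ a b c → a + b - c ≡ (a - c) + b
    rearrange = solve-∀
    shift : + (i ℕ.+ d) - τ ≡ (+ i - τ) + + d
    shift = trans (cong (_- τ) (pos-+ i d)) (rearrange (+ i) (+ d) τ)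

  InClass-period : ∀ d τ → 1 ℕ.≤ d → Σ< d (InClass d τ) ≡ 1
  InClass-period d τ d≥1 = count1 d (λ k → dec∣ (+ d) (+ k - τ)) t₀ uniq t₀<d (getCg t₀≡τ)
    where
    t₀ : ℕ
    t₀ = ZDM._%_ τ (+ d) {{nzpos d d≥1}}
    t₀<d : t₀ ℕ.< d
    t₀<d = ZDM.n%d<d τ (+ d) {{nzpos d d≥1}}
    t₀≡τ : Cg (+ d) (+ t₀) τ
    t₀≡τ = cg-mod d d≥1 τ
    uniq : ∀ t → t ℕ.< d → + d ∣ + t - τ → t ≡ t₀
    uniq t t<d h = resid-eq t t₀ t<d t₀<d (Cg-trans (cg h) (Cg-sym t₀≡τ))

  module LTE (p : ℕ) (pp : Prime p) (odd : ¬ (2 ℕD.∣ p)) where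
    P : ℤ
    P = + p
    p≥1 : 1 ℕ.≤ p
    p≥1 = prime≥1 pp

    module _ (x : ℤ) where
      geometric : ℕ → ℤ
      geometric zero = 0ℤ
      geometric (suc k) = x ^ k + geometric k

      geometric-factor : ∀ k → x ^ k - 1ℤ ≡ (x - 1ℤ) * geometric k
      geometric-factor zero = sym (*-zeroʳ (x - 1ℤ))
      geometric-factor (suc k) = begin
        x * x ^ k - 1ℤ                                     ≡⟨ split x (x ^ k) ⟩
        (x - 1ℤ) * x ^ k + (x ^ k - 1ℤ)                    ≡⟨ cong (λ z → (x - 1ℤ) * x ^ k + z) (geometric-factor k) ⟩
        (x - 1ℤ) * x ^ k + (x - 1ℤ) * geometric k          ≡⟨ sym (*-distribˡ-+ (x - 1ℤ) (x ^ k) (geometric k)) ⟩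
        (x - 1ℤ) * geometric (suc k)                       ∎
        where open ≡-Reasoning
              split : ∀ x X → x * X - 1ℤ ≡ (x - 1ℤ) * X + (X - 1ℤ)
              split = solve-∀

      module _ (m : ℤ) (x≡ : x ≡ 1ℤ + P * m) where
        pow-near-one : ∀ i → Σ ℤ λ a → x ^ i ≡ 1ℤ + + i * P * m + P * P * m * m * a
        pow-near-one zero = 0ℤ , base P m
          where base : ∀ P m → 1ℤ ≡ 1ℤ + 0ℤ * P * m + P * P * m * m * 0ℤ
                base = solve-∀
        pow-near-one (suc i) with pow-near-one i
        ... | a , e = (a + + i + P * m * a) , trans (cong₂ _*_ x≡ e) (trans (expand P m (+ i) a)
                        (cong (λ z → 1ℤ + z * P * m + P * P * m * m * (a + + i + P * m * a)) (sym (pos-+ 1 i))))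
          where expand : ∀ P m I a → (1ℤ + P * m) * (1ℤ + I * P * m + P * P * m * m * a)
                                   ≡ 1ℤ + (1ℤ + I) * P * m + P * P * m * m * (a + I + P * m * a)
                expand = solve-∀

        geometric-near-one : ∀ k → Σ ℤ λ b → geometric k ≡ + k + P * m * + T k + P * P * m * m * b
        geometric-near-one zero = 0ℤ , base P m
          where base : ∀ P m → 0ℤ ≡ 0ℤ + P * m * 0ℤ + P * P * m * m * 0ℤ
                base = solve-∀
        geometric-near-one (suc k) with pow-near-one k | geometric-near-one k
        ... | a , ea | b , eb = (a + b) , trans (cong₂ _+_ ea eb) (trans (collect P m (+ k) (+ T k) a b)
                                  (cong₂ (λ u v → u + P * m * v + P * P * m * m * (a + b)) (sym (pos-+ 1 k)) (sym (pos-+ (T k) k))))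
          where collect : ∀ P m K Tk a b → (1ℤ + K * P * m + P * P * m * m * a) + (K + P * m * Tk + P * P * m * m * b)
                                         ≡ (1ℤ + K) + P * m * (Tk + K) + P * P * m * m * (a + b)
                collect = solve-∀

        -- Since p ∣ T p (p odd), geometric p = p (1 + p (…)).
        geometric-p : Σ ℤ λ w → (geometric p ≡ P * w) × ¬ (P ∣ w)
        geometric-p = w , W≡ , p∤w
          where
          h : ℕ
          h = proj₁ (odd-form p odd)
          p≡ : p ≡ suc (2 ℕ.* h)
          p≡ = proj₂ (odd-form p odd)
          b : ℤ
          b = proj₁ (geometric-near-one p)
          w : ℤ
          w = 1ℤ + P * (m * + h + m * m * b)
          Tp≡ : T p ≡ p ℕ.* h
          Tp≡ = trans (cong T p≡) (trans (T-odd h) (cong (ℕ._* h) (sym p≡)))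
          factor : ∀ P m H b → P + P * m * (P * H) + P * P * m * m * b ≡ P * (1ℤ + P * (m * H + m * m * b))
          factor = solve-∀
          W≡ : geometric p ≡ P * w
          W≡ = trans (proj₂ (geometric-near-one p))
                 (trans (cong (λ z → + p + P * m * z + P * P * m * m * b) (trans (cong +_ Tp≡) (pos-* p h))) (factor P m (+ h) b))
          p∤w : ¬ (P ∣ w)
          p∤w d = ¬∣1 pp (∣m+n∣n⇒∣m d (∣m⇒∣m*n _ ∣-refl))

    lte1⇒ : ∀ x τ → P ∣ x ^ p - τ → P ∣ x - τ
    lte1⇒ x τ d = Cg-0' (Cg-trans (Cg-sym (Cg-+ (fermat pp x) (Cg-refl P (- τ)))) (Cg-0 d))

    lte1⇐ : ∀ x τ → P ∣ x - τ → P ∣ x ^ p - τ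
    lte1⇐ x τ d = Cg-0' (Cg-trans (Cg-+ (fermat pp x) (Cg-refl P (- τ))) (Cg-0 d))

    -- p ^ j ∣ a w with p ∤ w implies p ^ j ∣ a (compare valuations).
    coprime-cancel : ∀ j a w → ¬ (P ∣ w) → + (p ℕ.^ j) ∣ a * w → + (p ℕ.^ j) ∣ a
    coprime-cancel j a w p∤w d with ∣ a ∣ ℕP.≟ 0
    ... | yes a≡0 = ∣ᵤ⇒∣ (subst ((p ℕ.^ j) ℕD.∣_) (sym a≡0) (ℕD._∣0 (p ℕ.^ j)))
    ... | no a≢0 = ∣ᵤ⇒∣ (≤ν⇒^∣ p (∣ a ∣) j pp a≥1 (ℕP.≤-trans j≤ν[aw] (ℕP.≤-reflexive ν[aw]≡ν[a])))
      where
      a≥1 : 1 ℕ.≤ ∣ a ∣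
      a≥1 = ℕP.n≢0⇒n>0 a≢0
      w≥1 : 1 ℕ.≤ ∣ w ∣
      w≥1 = ℕP.n≢0⇒n>0 (λ w≡0 → p∤w (∣ᵤ⇒∣ (subst (p ℕD.∣_) (sym w≡0) (ℕD._∣0 p))))
      νw≡0 : ν p (∣ w ∣) ≡ 0
      νw≡0 = ν-char p (∣ w ∣) 0 (∣ w ∣) (prime≥2 pp) w≥1 (sym (ℕP.*-identityˡ _)) (λ d' → p∤w (∣ᵤ⇒∣ d'))
      ν[aw]≡ν[a] : ν p (∣ a ∣ ℕ.* ∣ w ∣) ≡ ν p (∣ a ∣)
      ν[aw]≡ν[a] = trans (ν-mul p (∣ a ∣) (∣ w ∣) pp a≥1 w≥1) (trans (cong (ν p (∣ a ∣) ℕ.+_) νw≡0) (ℕP.+-identityʳ _))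
      j≤ν[aw] : j ℕ.≤ ν p (∣ a ∣ ℕ.* ∣ w ∣)
      j≤ν[aw] = ^∣⇒≤ν p (∣ a ∣ ℕ.* ∣ w ∣) j pp (ℕP.*-mono-≤ a≥1 w≥1) (subst ((p ℕ.^ j) ℕD.∣_) (abs-* a w) (∣⇒∣ᵤ d))

    p^suc : ∀ j → + (p ℕ.^ suc j) ≡ + (p ℕ.^ j) * P
    p^suc j = trans (cong +_ (ℕP.*-comm p (p ℕ.^ j))) (pos-* (p ℕ.^ j) p)

    one-plus : ∀ x → P ∣ x - 1ℤ → Σ ℤ λ m → x ≡ 1ℤ + P * m
    one-plus x (divides m e) = m , trans (x≡1+[x-1] x) (cong (λ z → 1ℤ + z) (trans e (*-comm m P)))
      where x≡1+[x-1] : ∀ x → x ≡ 1ℤ + (x - 1ℤ)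
            x≡1+[x-1] = solve-∀

    -- Lifting the exponent for τ = 1 (j ≥ 1), both directions:
    -- p ^ (j+1) ∣ (x - 1) p w with p ∤ w iff p ^ j ∣ x - 1.
    lte-one⇒ : ∀ j → 1 ℕ.≤ j → ∀ x → + (p ℕ.^ suc j) ∣ x ^ p - 1ℤ → + (p ℕ.^ j) ∣ x - 1ℤ
    lte-one⇒ j j≥1 x d = coprime-cancel j (x - 1ℤ) w p∤w
        (*-cancelʳ-∣ P {{nzpos p p≥1}} (subst₂ _∣_ (p^suc j) (trans (geometric-factor x p) (trans (cong ((x - 1ℤ) *_) W≡) (reassoc (x - 1ℤ) P w))) d))
      where
      p∣x-1 : P ∣ x - 1ℤ
      p∣x-1 = lte1⇒ x 1ℤ (∣-trans (∣ᵤ⇒∣ (ℕD.divides (p ℕ.^ j) (ℕP.*-comm p (p ℕ.^ j)))) d)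
      m : ℤ
      m = proj₁ (one-plus x p∣x-1)
      factored : Σ ℤ λ w → (geometric x p ≡ P * w) × ¬ (P ∣ w)
      factored = geometric-p x m (proj₂ (one-plus x p∣x-1))
      w : ℤ
      w = proj₁ factored
      W≡ : geometric x p ≡ P * w
      W≡ = proj₁ (proj₂ factored)
      p∤w : ¬ (P ∣ w)
      p∤w = proj₂ (proj₂ factored)
      reassoc : ∀ a P w → a * (P * w) ≡ a * w * P
      reassoc = solve-∀

    lte-one⇐ : ∀ j → 1 ℕ.≤ j → ∀ x → + (p ℕ.^ j) ∣ x - 1ℤ → + (p ℕ.^ suc j) ∣ x ^ p - 1ℤ
    lte-one⇐ j j≥1 x d = subst₂ _∣_ (sym (p^suc j)) (sym (geometric-factor x p)) (*-pres-∣ d p∣W)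
      where
      p∣pʲ : P ∣ + (p ℕ.^ j)
      p∣pʲ = ∣ᵤ⇒∣ (ℕD.divides (p ℕ.^ (j ℕ.∸ 1)) (trans (cong (p ℕ.^_) (sym (ℕP.m∸n+n≡m j≥1)))
                    (trans (ℕP.^-distribˡ-+-* p (j ℕ.∸ 1) 1) (cong (p ℕ.^ (j ℕ.∸ 1) ℕ.*_) (ℕP.*-identityʳ p)))))
      p∣W : P ∣ geometric x p
      p∣W with one-plus x (∣-trans p∣pʲ d)
      ... | m , x≡ = subst (P ∣_) (sym (proj₁ (proj₂ (geometric-p x m x≡)))) (∣m⇒∣m*n _ ∣-refl)
      *-pres-∣ : ∀ {a b c d} → a ∣ b → c ∣ d → a * c ∣ b * d
      *-pres-∣ {a} {b} {c} {d} (divides k₁ e₁) (divides k₂ e₂) = divides (k₁ * k₂) (trans (cong₂ _*_ e₁ e₂) (interchange k₁ a k₂ c))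
        where interchange : ∀ k₁ a k₂ c → k₁ * a * (k₂ * c) ≡ k₁ * k₂ * (a * c)
              interchange = solve-∀

    -- The case τ = -1 follows from τ = 1 via x ↦ -x.
    neg-pow : ∀ x → (- x) ^ p ≡ - (x ^ p)
    neg-pow x = trans (cong (_^ p) (sym (-1*i≡-i x))) (trans (*-pow -1ℤ x p) (trans (cong (_* x ^ p) (-1^odd p odd)) (-1*i≡-i (x ^ p))))

    neg∣ : ∀ {d z} → d ∣ - z → d ∣ z
    neg∣ {d} {z} h = subst (d ∣_) (neg-involutive z) (∣m⇒∣-m h)

    negate-pow : ∀ x → (- x) ^ p - 1ℤ ≡ - (x ^ p - -1ℤ)
    negate-pow x = trans (cong (_- 1ℤ) (neg-pow x)) (negate-sum (x ^ p))
      where negate-sum : ∀ X → - X - 1ℤ ≡ - (X + 1ℤ)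
            negate-sum = solve-∀

    negate : ∀ x → (- x) - 1ℤ ≡ - (x - -1ℤ)
    negate = solve-∀

    lte⇒ : ∀ {τ} → IsSign τ → ∀ j → 1 ℕ.≤ j → ∀ x → + (p ℕ.^ suc j) ∣ x ^ p - τ → + (p ℕ.^ j) ∣ x - τ
    lte⇒ (inj₁ refl) j j≥1 x d = lte-one⇒ j j≥1 x d
    lte⇒ (inj₂ refl) j j≥1 x d = neg∣ (subst (_ ∣_) (negate x) (lte-one⇒ j j≥1 (- x) (subst (_ ∣_) (sym (negate-pow x)) (∣m⇒∣-m d))))

    lte⇐ : ∀ {τ} → IsSign τ → ∀ j → 1 ℕ.≤ j → ∀ x → + (p ℕ.^ j) ∣ x - τ → + (p ℕ.^ suc j) ∣ x ^ p - τ
    lte⇐ (inj₁ refl) j j≥1 x d = lte-one⇐ j j≥1 x d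
    lte⇐ (inj₂ refl) j j≥1 x d = neg∣ (subst (_ ∣_) (negate-pow x) (lte-one⇐ j j≥1 (- x) (subst (_ ∣_) (sym (negate x)) (∣m⇒∣-m d))))

    -- The roots of x ^ p ≡ τ mod p ^ (j+1) form the class of τ modulo p ^ max(j, 1).
    lte-modulus : ℕ → ℕ
    lte-modulus zero = p
    lte-modulus (suc j) = p ℕ.^ suc j

    lte-modulus≥1 : ∀ j → 1 ℕ.≤ lte-modulus j
    lte-modulus≥1 zero = p≥1
    lte-modulus≥1 (suc j) = ℕP.m^n>0 p {{ℕ.>-nonZero p≥1}} (suc j)

    Hit≡InClass : ∀ {τ} → IsSign τ → ∀ j k → Hit p p τ (suc j) k ≡ InClass (lte-modulus j) τ k
    Hit≡InClass {τ} τ± zero k = χ-cong (dec∣ (+ (p ℕ.^ 1)) ((+ k) ^ p - τ)) (dec∣ (+ p) (+ k - τ))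
      (λ d → lte1⇒ (+ k) τ (subst (_∣ ((+ k) ^ p - τ)) p¹≡p d))
      (λ d → subst (_∣ ((+ k) ^ p - τ)) (sym p¹≡p) (lte1⇐ (+ k) τ d))
      where p¹≡p = cong +_ (ℕP.*-identityʳ p)
    Hit≡InClass τ± (suc j) k = χ-cong (dec∣ _ _) (dec∣ _ _) (lte⇒ τ± (suc j) (ℕ.s≤s ℕ.z≤n) (+ k)) (lte⇐ τ± (suc j) (ℕ.s≤s ℕ.z≤n) (+ k))

module Legendre where

  -- Proof: telescope the one-step bounds M ⌊m/M⌋ ≤ m < M ⌊m/M⌋ + M applied to
  -- m = ⌊n / M ^ j⌋, using ⌊n / M ^ (j+1)⌋ = ⌊⌊n / M ^ j⌋ / M⌋.

  open FiniteSums
  open import Data.Nat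
  open import Data.Nat.Properties
  open import Data.Nat.DivMod
  open import Relation.Binary.PropositionalEquality
  import Data.Nat.Tactic.RingSolver as ℕ-Solver

  module LegendreSum (M' : ℕ) (n : ℕ) where
    M : ℕ
    M = suc M'

    nz^ : ∀ j → NonZero (M ^ j)
    nz^ j = m^n≢0 M j

    quot : ℕ → ℕ
    quot j = (n / (M ^ j)) {{nz^ j}}

    quot-suc : ∀ j → quot (suc j) ≡ quot j / M
    quot-suc j = sym (trans (m/n/o≡m/[n*o] n (M ^ j) M {{nz^ j}} {{_}} {{m*n≢0 (M ^ j) M {{nz^ j}}}})
                            (divisor-≡ (*-comm (M ^ j) M) {{m*n≢0 (M ^ j) M {{nz^ j}}}} {{nz^ (suc j)}}))
      where divisor-≡ : ∀ {b c} → b ≡ c → .{{_ : NonZero b}} .{{_ : NonZero c}} → n / b ≡ n / c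
            divisor-≡ refl = refl

    S : ℕ → ℕ
    S J = Σ< J (λ j → quot (suc j))

    telescope-upper : ∀ J → M' * S J + quot J ≤ n
    telescope-upper zero = ≤-reflexive (trans (cong (_+ quot 0) (*-zeroʳ M')) (n/1≡n n))
    telescope-upper (suc J) = begin
      M' * S (suc J) + quot (suc J)            ≡⟨ cong (λ z → M' * z + quot (suc J)) (Σ-last J (λ j → quot (suc j))) ⟩
      M' * (S J + quot (suc J)) + quot (suc J) ≡⟨ regroup M' (S J) (quot (suc J)) ⟩
      M' * S J + quot (suc J) * M              ≤⟨ +-monoʳ-≤ (M' * S J) (subst (λ z → z * M ≤ quot J) (sym (quot-suc J)) (m/n*n≤m (quot J) M)) ⟩
      M' * S J + quot J                        ≤⟨ telescope-upper J ⟩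
      n                                        ∎
      where open ≤-Reasoning
            regroup : ∀ a s y → a * (s + y) + y ≡ a * s + y * suc a
            regroup = ℕ-Solver.solve-∀

    telescope-lower : ∀ J → n ≤ M' * S J + quot J + M * J
    telescope-lower zero = ≤-reflexive (sym (trans (cong₂ (λ a b → a + quot 0 + b) (*-zeroʳ M') (*-zeroʳ M)) (trans (+-identityʳ (quot 0)) (n/1≡n n))))
    telescope-lower (suc J) = begin
      n                                           ≤⟨ telescope-lower J ⟩
      M' * S J + quot J + M * J                   ≤⟨ +-monoˡ-≤ (M * J) (+-monoʳ-≤ (M' * S J) quot-J≤) ⟩
      M' * S J + (quot (suc J) * M + M) + M * J   ≡⟨ regroup M' (S J) (quot (suc J)) J ⟩
      M' * (S J + quot (suc J)) + quot (suc J) + M * suc J ≡⟨ cong (λ z → M' * z + quot (suc J) + M * suc J) (sym (Σ-last J (λ j → quot (suc j)))) ⟩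
      M' * S (suc J) + quot (suc J) + M * suc J   ∎
      where
      open ≤-Reasoning
      regroup : ∀ a s y J → a * s + (y * suc a + suc a) + suc a * J ≡ a * (s + y) + y + suc a * suc J
      regroup = ℕ-Solver.solve-∀
      quot-J≤ : quot J ≤ quot (suc J) * M + M
      quot-J≤ = begin
        quot J                              ≡⟨ m≡m%n+[m/n]*n (quot J) M ⟩
        quot J % M + (quot J / M) * M       ≤⟨ +-monoˡ-≤ _ (<⇒≤ (m%n<n (quot J) M)) ⟩
        M + (quot J / M) * M                ≡⟨ +-comm M _ ⟩
        (quot J / M) * M + M                ≡⟨ cong (λ z → z * M + M) (sym (quot-suc J)) ⟩
        quot (suc J) * M + M                ∎

    -- The Legendre bounds; the lower one needs n < M ^ J, when ⌊n / M ^ J⌋ = 0.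
    legendre-upper : ∀ J → M' * S J ≤ n
    legendre-upper J = ≤-trans (m≤m+n (M' * S J) _) (telescope-upper J)

    legendre-lower : ∀ J → n < M ^ J → n ≤ M' * S J + M * J
    legendre-lower J n<Mᴶ = ≤-trans (telescope-lower J)
      (≤-reflexive (cong (_+ M * J) (trans (cong (M' * S J +_) (m<n⇒m/n≡0 {{nz^ J}} n<Mᴶ)) (+-identityʳ (M' * S J)))))

module BinaryLength where

  -- L n bounds the number of prime-power levels that can divide Q(k) for
  -- k ≤ n, and the error terms of the asymptotics are O(L n).

  open import Data.Nat
  open import Data.Nat.Properties
  open import Data.Product using (Σ; _×_; _,_; proj₁; proj₂)
  open import Data.Empty
  open import Relation.Nullary
  open import Relation.Binary.PropositionalEquality
  import Data.Nat.Tactic.RingSolver as ℕ-Solver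

  L-step : (n l : ℕ) → Dec (suc (suc n) < 2 ^ l) → ℕ
  L-step n l (yes _) = l
  L-step n l (no _) = suc l

  L : ℕ → ℕ
  L zero = 1
  L (suc n) = L-step n (L n) (suc (suc n) <? 2 ^ L n)

  L-bounds : ∀ n → (suc n < 2 ^ L n) × (2 ^ L n ≤ 2 * suc n)
  L-bounds zero = ≤-refl , ≤-refl
  L-bounds (suc n) = step (suc (suc n) <? 2 ^ L n)
    where
    ih : (suc n < 2 ^ L n) × (2 ^ L n ≤ 2 * suc n)
    ih = L-bounds n
    x<2x : ∀ x → 1 ≤ x → suc x ≤ 2 * x
    x<2x x x≥1 = ≤-trans (+-monoˡ-≤ x x≥1) (≤-reflexive (cong (x +_) (sym (+-identityʳ x))))
    step : (d : Dec (suc (suc n) < 2 ^ L n)) → (suc (suc n) < 2 ^ L-step n (L n) d) × (2 ^ L-step n (L n) d ≤ 2 * suc (suc n))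
    step (yes lt) = lt , ≤-trans (proj₂ ih) (*-monoʳ-≤ 2 (n≤1+n (suc n)))
    step (no ≮) = ≤-trans (s≤s (proj₁ ih)) (x<2x (2 ^ L n) (m^n>0 2 (L n))) , *-monoʳ-≤ 2 (≮⇒≥ ≮)

  L≥1 : ∀ n → Σ ℕ λ l → L n ≡ suc l
  L≥1 n with L n | L-bounds n
  ... | zero | (lt , _) = ⊥-elim (<-irrefl refl (≤-trans (s≤s z≤n) (≤-pred lt)))
  ... | suc l | _ = l , refl

  quadratic : ℕ → ℕ
  quadratic C = 2 * C * (2 * C + 5) + 2

  -- The base case, by induction on C.
  quadratic≤ : ∀ C → quadratic C ≤ 16 * 4 ^ C
  quadratic≤ zero = s≤s (s≤s z≤n)
  quadratic≤ (suc zero) = m≤m+n 16 48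
  quadratic≤ (suc (suc C)) = begin
    quadratic (suc (suc C))                                    ≤⟨ m≤m+n _ (12 * C * C + 46 * C + 26) ⟩
    quadratic (suc (suc C)) + (12 * C * C + 46 * C + 26)       ≡⟨ grow C ⟩
    4 * quadratic (suc C)                                      ≤⟨ *-monoʳ-≤ 4 (quadratic≤ (suc C)) ⟩
    4 * (16 * 4 ^ suc C)                                       ≡⟨ swap (4 ^ suc C) ⟩
    16 * 4 ^ suc (suc C)                                       ∎
    where open ≤-Reasoning
          grow : ∀ C → (2 * (2 + C) * (2 * (2 + C) + 5) + 2) + (12 * C * C + 46 * C + 26) ≡ 4 * (2 * (1 + C) * (2 * (1 + C) + 5) + 2)
          grow = ℕ-Solver.solve-∀
          swap : ∀ X → 4 * (16 * X) ≡ 16 * (4 * X)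
          swap = ℕ-Solver.solve-∀

  linear≤exp : ∀ C ℓ → 2 * C + 4 ≤ ℓ → 2 * C * (ℓ + 1) + 2 ≤ 2 ^ ℓ
  linear≤exp C ℓ le with 2 * C + 4 ≟ ℓ
  ... | yes refl = subst₂ _≤_ (cong (λ z → 2 * C * z + 2) (sym (+-assoc (2 * C) 4 1))) (sym 2^[2C+4]) (quadratic≤ C)
    where 2^[2C+4] : 2 ^ (2 * C + 4) ≡ 16 * 4 ^ C
          2^[2C+4] = trans (^-distribˡ-+-* 2 (2 * C) 4) (trans (*-comm (2 ^ (2 * C)) 16) (cong (16 *_) (sym (^-*-assoc 2 2 C))))
  linear≤exp C zero le | no ne = ⊥-elim (ne (n≤0⇒n≡0 le))
  linear≤exp C (suc ℓ) le | no ne = begin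
    2 * C * (suc ℓ + 1) + 2          ≡⟨ regroup (2 * C) ℓ ⟩
    (2 * C * (ℓ + 1) + 2) + 2 * C    ≤⟨ +-mono-≤ ih (≤-trans (m≤m*n (2 * C) (ℓ + 1) {{ℓ+1≢0}}) (≤-trans (m≤m+n _ 2) ih)) ⟩
    2 ^ ℓ + 2 ^ ℓ                    ≡⟨ cong (2 ^ ℓ +_) (sym (+-identityʳ (2 ^ ℓ))) ⟩
    2 ^ suc ℓ                        ∎
    where
    open ≤-Reasoning
    ih : 2 * C * (ℓ + 1) + 2 ≤ 2 ^ ℓ
    ih = linear≤exp C ℓ (≤-pred (≤∧≢⇒< le ne))
    regroup : ∀ c ℓ → c * (suc ℓ + 1) + 2 ≡ (c * (ℓ + 1) + 2) + c
    regroup = ℕ-Solver.solve-∀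
    ℓ+1≢0 : NonZero (ℓ + 1)
    ℓ+1≢0 = subst NonZero (+-comm 1 ℓ) _

  sublinear : ∀ C → Σ ℕ λ N → ∀ n → N ≤ n → C * (L n + 1) < n
  sublinear C = 2 ^ ℓ₀ , bound
    where
    ℓ₀ : ℕ
    ℓ₀ = 2 * suc C + 4
    bound : ∀ n → 2 ^ ℓ₀ ≤ n → C * (L n + 1) < n
    bound n N≤n = ≤-trans C<suc-C (≤-pred (subst (_≤ suc n) (+-comm (suc C * (ℓ + 1)) 1) (*-cancelˡ-≤ 2 twice)))
      where
      ℓ : ℕ
      ℓ = L n
      ℓ₀≤ℓ : ℓ₀ ≤ ℓ
      ℓ₀≤ℓ with ℓ₀ ≤? ℓ
      ... | yes ≤ℓ = ≤ℓ
      ... | no ≰ℓ = ⊥-elim (<-irrefl refl (<-≤-trans (<-trans (n<1+n n) (proj₁ (L-bounds n)))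
                                           (≤-trans (^-monoʳ-≤ 2 (n≤1+n ℓ)) (≤-trans (^-monoʳ-≤ 2 (≰⇒> ≰ℓ)) N≤n))))
      double : ∀ C ℓ → 2 * (C * (ℓ + 1) + 1) ≡ 2 * C * (ℓ + 1) + 2
      double = ℕ-Solver.solve-∀
      twice : 2 * (suc C * (ℓ + 1) + 1) ≤ 2 * suc n
      twice = ≤-trans (≤-reflexive (double (suc C) ℓ)) (≤-trans (linear≤exp (suc C) ℓ ℓ₀≤ℓ) (proj₂ (L-bounds n)))
      expand : ∀ C l → suc C * (l + 1) ≡ suc (C * (l + 1) + l)
      expand = ℕ-Solver.solve-∀
      C<suc-C : C * (ℓ + 1) < suc C * (ℓ + 1)
      C<suc-C = subst (C * (ℓ + 1) <_) (sym (expand C ℓ)) (s≤s (m≤m+n _ _))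

  n<b^L : ∀ b → 2 ≤ b → ∀ n → n < b ^ L n
  n<b^L b b≥2 n = <-≤-trans (<-trans (n<1+n n) (proj₁ (L-bounds n))) (^-monoˡ-≤ (L n) b≥2)

module Asymptotics where

  -- Indeed |a n / (A n / D) - 1| = |D a n - A n| / (A n)
  -- ≤ K (L n + 1) / (A n), which drops below any ε > 0 by sublinearity of L.

  open import Defs
  open BinaryLength using (L; sublinear)
  open import Data.Nat as ℕ using (ℕ; zero; suc)
  import Data.Nat.Properties as ℕP
  open import Data.Integer as ℤ using (ℤ; +_; +<+; -[1+_])
  import Data.Integer.Properties as ℤP
  open import Data.Integer.Tactic.RingSolver
  open import Data.Rational as Q using (ℚ; mkℚ; 0ℚ; 1ℚ; toℚᵘ; _÷_)
  import Data.Rational.Properties as QP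
  open import Data.Rational.Unnormalised as U using (ℚᵘ; mkℚᵘ; *≡*)
  import Data.Rational.Unnormalised.Properties as UP
  open import Data.Product using (_×_; _,_; proj₁; proj₂)
  open import Data.Sum using (inj₁; inj₂)
  open import Data.Empty
  open import Relation.Nullary
  open import Relation.Binary.PropositionalEquality
  import Data.Nat.Tactic.RingSolver as ℕ-Solver

  -- The arithmetic core of ε-closeness: from |z| d = U ≤ E and e E < d
  -- (z = zn/s in lowest terms, ε = (k+1)/e) it follows that |zn| e < (k+1) s.
  cross-multiply : ∀ zn e s d U E k → zn ℕ.* d ≡ U ℕ.* s → U ℕ.≤ E → e ℕ.* E ℕ.< d → 1 ℕ.≤ s →
                   zn ℕ.* e ℕ.< suc k ℕ.* s
  cross-multiply zn e s d U E k eq U≤E eE<d s≥1 = ℕP.*-cancelʳ-< d (zn ℕ.* e) (suc k ℕ.* s) (begin-strict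
    zn ℕ.* e ℕ.* d      ≡⟨ swap₂₃ zn e d ⟩
    zn ℕ.* d ℕ.* e      ≡⟨ cong (ℕ._* e) eq ⟩
    U ℕ.* s ℕ.* e       ≤⟨ ℕP.*-monoˡ-≤ e (ℕP.*-monoˡ-≤ s U≤E) ⟩
    E ℕ.* s ℕ.* e       ≡⟨ rotate E s e ⟩
    e ℕ.* E ℕ.* s       <⟨ ℕP.*-monoˡ-< s {{ℕ.>-nonZero s≥1}} eE<d ⟩
    d ℕ.* s             ≡⟨ ℕP.*-comm d s ⟩
    s ℕ.* d             ≤⟨ ℕP.*-monoˡ-≤ d (ℕP.m≤n*m s (suc k)) ⟩
    suc k ℕ.* s ℕ.* d   ∎)
    where
    open ℕP.≤-Reasoning
    swap₂₃ : ∀ a b c → a ℕ.* b ℕ.* c ≡ a ℕ.* c ℕ.* b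
    swap₂₃ = ℕ-Solver.solve-∀
    rotate : ∀ a b c → a ℕ.* b ℕ.* c ≡ c ℕ.* a ℕ.* b
    rotate = ℕ-Solver.solve-∀

  small-if-scaled-small : ∀ (z : ℚ) (d U E : ℕ) (ε : ℚ) → 0ℚ Q.< ε →
    U.∣ toℚᵘ z ∣ U.* mkℚᵘ (+ d) 0 U.≃ mkℚᵘ (+ U) 0 → U ℕ.≤ E → Q.↧ₙ ε ℕ.* E ℕ.< d → Q.∣ z ∣ Q.< ε
  small-if-scaled-small (mkℚ zn zd _) d U E (mkℚ (+ zero) _ _) (Q.*<* (+<+ ()))
  small-if-scaled-small (mkℚ zn zd _) d U E (mkℚ -[1+ m ] _ _) (Q.*<* ())
  small-if-scaled-small (mkℚ zn zd _) d U E (mkℚ (+ suc k) e-1 _) _ (*≡* eq) U≤E eE<d =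
    Q.*<* (subst₂ ℤ._<_ (ℤP.pos-* ℤ.∣ zn ∣ (suc e-1)) (ℤP.pos-* (suc k) (suc zd))
            (+<+ (cross-multiply ℤ.∣ zn ∣ (suc e-1) (suc zd) d U E k eqℕ U≤E eE<d (ℕ.s≤s ℕ.z≤n))))
    where
    eqℕ : ℤ.∣ zn ∣ ℕ.* d ≡ U ℕ.* suc zd
    eqℕ = ℤP.+-injective (begin
      + (ℤ.∣ zn ∣ ℕ.* d)            ≡⟨ ℤP.pos-* ℤ.∣ zn ∣ d ⟩
      + ℤ.∣ zn ∣ ℤ.* + d            ≡⟨ sym (ℤP.*-identityʳ _) ⟩
      + ℤ.∣ zn ∣ ℤ.* + d ℤ.* + 1    ≡⟨ eq ⟩
      + U ℤ.* + suc (zd ℕ.* 1)      ≡⟨ cong (λ w → + U ℤ.* + suc w) (ℕP.*-identityʳ zd) ⟩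
      + U ℤ.* + suc zd              ≡⟨ sym (ℤP.pos-* U (suc zd)) ⟩
      + (U ℕ.* suc zd)              ∎)
      where open ≡-Reasoning

  ∣-∣≤ : ∀ x y E → x ℕ.≤ y ℕ.+ E → y ℕ.≤ x ℕ.+ E → ℤ.∣ + x ℤ.- + y ∣ ℕ.≤ E
  ∣-∣≤ x y E x≤ y≤ with ℕP.≤-total y x
  ... | inj₁ y≤x = subst (ℕ._≤ E) (sym (cong ℤ.∣_∣ (trans (ℤP.m-n≡m⊖n x y) (ℤP.⊖-≥ y≤x)))) (ℕP.m≤n+o⇒m∸n≤o x y x≤)
  ... | inj₂ x≤y = subst (ℕ._≤ E) (sym (trans (cong ℤ.∣_∣ (ℤP.m-n≡m⊖n x y)) (trans (ℤP.∣m⊖n∣≡∣n⊖m∣ x y) (cong ℤ.∣_∣ (ℤP.⊖-≥ x≤y))))) (ℕP.m≤n+o⇒m∸n≤o y x y≤)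

  toℚᵘ-toℚ : ∀ m → toℚᵘ (toℚ m) U.≃ mkℚᵘ (+ m) 0
  toℚᵘ-toℚ m = QP.toℚᵘ-fromℚᵘ (mkℚᵘ (+ m) 0)

  toℚ≡0 : ∀ m → toℚ m ≡ 0ℚ → m ≡ 0
  toℚ≡0 m e with UP.≃-trans (UP.≃-sym (toℚᵘ-toℚ m)) (QP.toℚᵘ-cong e)
  ... | *≡* eq = ℤP.+-injective (trans (sym (ℤP.*-identityʳ (+ m))) eq)

  ÷₀-≢0 : ∀ a b → (b≢0 : b ≢ 0ℚ) → a ÷₀ b ≡ (a ÷ b) {{Q.≢-nonZero b≢0}}
  ÷₀-≢0 a b b≢0 with b QP.≟ 0ℚ
  ... | yes b≡0 = ⊥-elim (b≢0 b≡0)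
  ... | no _ = refl

  ÷-* : ∀ a b → (b≢0 : b ≢ 0ℚ) → (a ÷ b) {{Q.≢-nonZero b≢0}} Q.* b ≡ a
  ÷-* a b b≢0 = trans (QP.*-assoc a _ b) (trans (cong (a Q.*_) (QP.*-inverseˡ b {{Q.≢-nonZero b≢0}})) (QP.*-identityʳ a))

  -- The relative error of x = a n against y = (A n)/D, multiplied by A n:
  --   |x / y - 1| · (A n) = |D · a n - A n|   (as unnormalised rationals).
  module RelativeError (A D : ℕ) (A≥1 : 1 ℕ.≤ A) (D≥1 : 1 ℕ.≤ D) (a n : ℕ) (n≥1 : 1 ℕ.≤ n) where

    d : ℕ
    d = A ℕ.* n
    x : ℚ
    x = toℚ a
    y : ℚ
    y = toℚ d ÷₀ toℚ D

    D≢0 : toℚ D ≢ 0ℚ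
    D≢0 e = ℕP.<-irrefl refl (ℕP.≤-trans D≥1 (ℕP.≤-reflexive (toℚ≡0 D e)))

    yD≡d : y Q.* toℚ D ≡ toℚ d
    yD≡d = trans (cong (Q._* toℚ D) (÷₀-≢0 (toℚ d) (toℚ D) D≢0)) (÷-* (toℚ d) (toℚ D) D≢0)

    y≢0 : y ≢ 0ℚ
    y≢0 e = ℕP.<-irrefl refl (ℕP.≤-trans (ℕP.*-mono-≤ A≥1 n≥1)
              (ℕP.≤-reflexive (toℚ≡0 d (trans (sym yD≡d) (trans (cong (Q._* toℚ D) e) (QP.*-zeroˡ (toℚ D)))))))

    r : ℚ
    r = x ÷₀ y

    ry≡x : r Q.* y ≡ x
    ry≡x = trans (cong (Q._* y) (÷₀-≢0 x y y≢0)) (÷-* x y y≢0)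

    scaled : (r Q.- 1ℚ) Q.* toℚ d ≡ x Q.* toℚ D Q.- toℚ d
    scaled = begin
      (r Q.+ Q.- 1ℚ) Q.* toℚ d               ≡⟨ QP.*-distribʳ-+ (toℚ d) r (Q.- 1ℚ) ⟩
      r Q.* toℚ d Q.+ Q.- 1ℚ Q.* toℚ d       ≡⟨ cong₂ Q._+_ rd≡xD (trans (sym (QP.neg-distribˡ-* 1ℚ (toℚ d))) (cong Q.-_ (QP.*-identityˡ (toℚ d)))) ⟩
      x Q.* toℚ D Q.+ Q.- toℚ d              ∎
      where
      open ≡-Reasoning
      rd≡xD : r Q.* toℚ d ≡ x Q.* toℚ D
      rd≡xD = trans (cong (r Q.*_) (sym yD≡d)) (trans (sym (QP.*-assoc r y (toℚ D))) (cong (Q._* toℚ D) ry≡x))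

    numerator : ℚᵘ
    numerator = mkℚᵘ (+ a) 0 U.* mkℚᵘ (+ D) 0 U.- mkℚᵘ (+ d) 0

    numerator≡ : U.↥ numerator ≡ + (D ℕ.* a) ℤ.- + d
    numerator≡ = trans (drop-ones (+ a) (+ D) (+ d)) (cong (ℤ._- + d) (trans (ℤP.*-comm (+ a) (+ D)) (sym (ℤP.pos-* D a))))
      where drop-ones : ∀ x y z → x ℤ.* y ℤ.* + 1 ℤ.+ ℤ.- z ℤ.* + 1 ≡ x ℤ.* y ℤ.- z
            drop-ones = solve-∀

    error-scaled : U.∣ toℚᵘ (r Q.- 1ℚ) ∣ U.* mkℚᵘ (+ d) 0 U.≃ mkℚᵘ (+ ℤ.∣ U.↥ numerator ∣) 0
    error-scaled = UP.≃-trans (UP.≃-reflexive (sym (UP.∣p*q∣≡∣p∣*∣q∣ (toℚᵘ (r Q.- 1ℚ)) (mkℚᵘ (+ d) 0)))) (UP.∣-∣-cong in-ℚᵘ)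
      where
      in-ℚᵘ : toℚᵘ (r Q.- 1ℚ) U.* mkℚᵘ (+ d) 0 U.≃ numerator
      in-ℚᵘ = UP.≃-trans (UP.≃-sym (UP.≃-trans (QP.toℚᵘ-homo-* (r Q.- 1ℚ) (toℚ d)) (UP.*-congˡ {toℚᵘ (r Q.- 1ℚ)} (toℚᵘ-toℚ d))))
             (UP.≃-trans (QP.toℚᵘ-cong scaled)
               (UP.≃-trans (QP.toℚᵘ-homo-+ (x Q.* toℚ D) (Q.- toℚ d))
                 (UP.+-cong (UP.≃-trans (QP.toℚᵘ-homo-* x (toℚ D)) (UP.*-cong (toℚᵘ-toℚ a) (toℚᵘ-toℚ D)))
                            (UP.≃-trans (QP.toℚᵘ-homo‿- (toℚ d)) (UP.-‿cong (toℚᵘ-toℚ d))))))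

  log-error⇒∼ : ∀ (a : ℕ → ℕ) (A D K : ℕ) → 1 ℕ.≤ A → 1 ℕ.≤ D →
    (∀ n → (D ℕ.* a n ℕ.≤ A ℕ.* n ℕ.+ K ℕ.* (L n ℕ.+ 1)) × (A ℕ.* n ℕ.≤ D ℕ.* a n ℕ.+ K ℕ.* (L n ℕ.+ 1))) →
    (λ n → toℚ (a n)) ∼ (λ n → toℚ (A ℕ.* n) ÷₀ toℚ D)
  log-error⇒∼ a A D K A≥1 D≥1 bounds ε ε>0 = N , close
    where
    e : ℕ
    e = Q.↧ₙ ε
    N₁ : ℕ
    N₁ = proj₁ (sublinear (e ℕ.* K))
    N : ℕ
    N = N₁ ℕ.⊔ 1
    close : ∀ n → N ℕ.≤ n → Q.∣ (toℚ (a n) ÷₀ (toℚ (A ℕ.* n) ÷₀ toℚ D)) Q.- 1ℚ ∣ Q.< ε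
    close n N≤n = small-if-scaled-small (r Q.- 1ℚ) d _ E ε ε>0 error-scaled U≤E eE<An
      where
      n≥1 : 1 ℕ.≤ n
      n≥1 = ℕP.≤-trans (ℕP.m≤n⊔m N₁ 1) N≤n
      open RelativeError A D A≥1 D≥1 (a n) n n≥1
      E : ℕ
      E = K ℕ.* (L n ℕ.+ 1)
      U≤E : ℤ.∣ U.↥ numerator ∣ ℕ.≤ E
      U≤E = subst (ℕ._≤ E) (sym (cong ℤ.∣_∣ numerator≡)) (∣-∣≤ (D ℕ.* a n) (A ℕ.* n) E (proj₁ (bounds n)) (proj₂ (bounds n)))
      eE<An : e ℕ.* E ℕ.< A ℕ.* n
      eE<An = ℕP.<-≤-trans (subst (ℕ._< n) (ℕP.*-assoc e K (L n ℕ.+ 1)) (proj₂ (sublinear (e ℕ.* K)) n (ℕP.≤-trans (ℕP.m≤m⊔n N₁ 1) N≤n)))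
                           (ℕP.m≤n*m n A {{ℕ.>-nonZero A≥1}})

module Recurrence where

  -- Since t_n = Π_{n₀ < k ≤ n} Q(k),
  --   ν_q(t_n) = Σ_{n₀ < k ≤ n} ν_q(Q(k)) = Σ_{j < J} #{n₀ < k ≤ n | q^(j+1) ∣ Q(k)},
  -- where J = p · L n bounds the valuations because Q(k) < q ^ (J + 1).
  -- Each level j counts a periodic set (period d_j, r_j hits per period) up
  -- to the ≤ n₀ excluded indices, which squeezes ν_q(t_n) between
  -- Σ_j r_j ⌊n/d_j⌋ - J n₀ and Σ_j (r_j ⌊n/d_j⌋ + r_j).

  open import Defs
  open FiniteSums
  open Valuation
  open Congruence using (dec∣; pow-pos)
  open RootsModPrime using (IsSign; Hit)
  open BinaryLength using (L; L-bounds)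
  open import Data.Nat as ℕ
  open import Data.Nat.Properties
  open import Data.Nat.Divisibility using (_∣_; _∣?_)
  open import Data.Nat.Primality
  open import Data.Integer as ℤ using (ℤ; +_; 1ℤ; -1ℤ)
  import Data.Integer.Properties as ℤP
  import Data.Integer.Divisibility.Signed as ℤD
  open import Data.Product using (_×_; _,_; proj₁; proj₂)
  open import Data.Sum using (inj₁; inj₂)
  open import Data.Empty
  open import Relation.Nullary
  open import Relation.Binary.PropositionalEquality hiding (J)
  import Data.Nat.Tactic.RingSolver as ℕ-Solver

  -- Q s p k = |k ^ p - τ s| with τ plus = -1 and τ minus = 1.
  τ : PM → ℤ
  τ plus = -1ℤ
  τ minus = 1ℤ

  τ-sign : ∀ s → IsSign (τ s)
  τ-sign plus = inj₂ refl
  τ-sign minus = inj₁ refl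

  -- For k ≥ 1, Q(k) is the absolute value of k ^ p - τ (no truncation in Q minus).
  Q≡∣kᵖ-τ∣ : ∀ s p k → 1 ≤ k → ℤ.∣ (+ k) ℤ.^ p ℤ.- τ s ∣ ≡ Q s p k
  Q≡∣kᵖ-τ∣ plus p k k≥1 = trans (cong (λ z → ℤ.∣ z ℤ.+ 1ℤ ∣) (pow-pos k p)) (cong ℤ.∣_∣ (sym (ℤP.pos-+ (k ^ p) 1)))
  Q≡∣kᵖ-τ∣ minus p k k≥1 = trans (cong (λ z → ℤ.∣ z ℤ.- 1ℤ ∣) (pow-pos k p))
    (cong ℤ.∣_∣ (trans (ℤP.m-n≡m⊖n (k ^ p) 1) (ℤP.⊖-≥ (m^n>0 k {{>-nonZero k≥1}} p))))

  ∣Q⇔ : ∀ s p k m → 1 ≤ k → (m ∣ Q s p k → (+ m) ℤD.∣ ((+ k) ℤ.^ p ℤ.- τ s)) × ((+ m) ℤD.∣ ((+ k) ℤ.^ p ℤ.- τ s) → m ∣ Q s p k)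
  ∣Q⇔ s p k m k≥1 = (λ d → ℤD.∣ᵤ⇒∣ (subst (m ∣_) (sym (Q≡∣kᵖ-τ∣ s p k k≥1)) d))
                  , (λ d → subst (m ∣_) (Q≡∣kᵖ-τ∣ s p k k≥1) (ℤD.∣⇒∣ᵤ d))

  -- k ^ p + 1 ≤ (k + 1) ^ p, so Q(k) < (n + 1) ^ p for k ≤ n.
  pow-+1 : ∀ k p → 1 ≤ p → k ^ p + 1 ≤ (k + 1) ^ p
  pow-+1 k (suc zero) _ = ≤-reflexive (trans (cong (_+ 1) (*-identityʳ k)) (sym (*-identityʳ (k + 1))))
  pow-+1 k (suc (suc p)) _ = begin
    k * k ^ suc p + 1                       ≤⟨ +-monoʳ-≤ (k * k ^ suc p) (m≤m+n 1 _) ⟩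
    k * k ^ suc p + (1 + (k + k ^ suc p))   ≡⟨ expand k (k ^ suc p) ⟩
    (k + 1) * (k ^ suc p + 1)               ≤⟨ *-monoʳ-≤ (k + 1) (pow-+1 k (suc p) (s≤s z≤n)) ⟩
    (k + 1) * (k + 1) ^ suc p               ∎
    where open ≤-Reasoning
          expand : ∀ k X → k * X + (1 + (k + X)) ≡ (k + 1) * (X + 1)
          expand = ℕ-Solver.solve-∀

  Q≤ : ∀ s p k → Q s p k ≤ k ^ p + 1
  Q≤ plus p k = ≤-refl
  Q≤ minus p k = ≤-trans (m∸n≤m (k ^ p) 1) (m≤m+n _ 1)

  module Setup (p : ℕ) (pp : Prime p) (s : PM) (n₀ : ℕ)
                    (zeros<n₀ : ∀ (x : ℕ) → 1 ≤ x → Q s p x ≡ 0 → x < n₀) where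

    p≥1 : 1 ≤ p
    p≥1 = prime≥1 pp

    -- Q(k) ≥ 1 for k > n₀ and t_n ≥ 1, since all zeros of Q lie below n₀.
    Q≥1 : ∀ k → n₀ < k → 1 ≤ Q s p k
    Q≥1 k n₀<k = n≢0⇒n>0 (λ Q≡0 → <-asym n₀<k (zeros<n₀ k (≤-trans (s≤s z≤n) n₀<k) Q≡0))

    t≥1 : ∀ n → 1 ≤ t s p n₀ n
    t≥1 zero = ≤-refl
    t≥1 (suc n) with n₀ ≤? n
    ... | yes n₀≤n = *-mono-≤ (Q≥1 (suc n) (s≤s n₀≤n)) (t≥1 n)
    ... | no _ = ≤-refl

    J : ℕ → ℕ
    J n = L n * p

    module AtPrime (q : ℕ) (pq : Prime q) where

      term : ℕ → ℕ
      term k = χ (n₀ <? k) * ν q (Q s p k)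

      term≡0 : ∀ k → k ≤ n₀ → term k ≡ 0
      term≡0 k k≤n₀ = cong (_* ν q (Q s p k)) (χ-no (n₀ <? k) (λ lt → <-irrefl refl (≤-trans lt k≤n₀)))

      ν-t : ∀ n → ν q (t s p n₀ n) ≡ Σ< n (λ i → term (suc i))
      ν-t zero = ν-one q (prime≥2 pq)
      ν-t (suc n) with n₀ ≤? n
      ... | yes n₀≤n = begin
        ν q (Q s p (suc n) * t s p n₀ n)              ≡⟨ ν-mul q _ _ pq (Q≥1 (suc n) (s≤s n₀≤n)) (t≥1 n) ⟩
        ν q (Q s p (suc n)) + ν q (t s p n₀ n)        ≡⟨ cong₂ _+_ (sym (trans (cong (_* ν q (Q s p (suc n))) (χ-yes (n₀ <? suc n) (s≤s n₀≤n))) (*-identityˡ _))) (ν-t n) ⟩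
        term (suc n) + Σ< n (λ i → term (suc i))      ≡⟨ +-comm (term (suc n)) _ ⟩
        Σ< n (λ i → term (suc i)) + term (suc n)      ≡⟨ sym (Σ-last n (λ i → term (suc i))) ⟩
        Σ< (suc n) (λ i → term (suc i))               ∎
        where open ≡-Reasoning
      ... | no n₀≰n = trans (ν-one q (prime≥2 pq)) (sym (trans (Σ-cong (suc n) (λ i i<1+n → term≡0 (suc i) (≤-trans i<1+n (≰⇒> n₀≰n)))) (Σ-zero (suc n))))

      hit : ℕ → ℕ → ℕ
      hit = Hit q p (τ s)

      Q<q^[J+1] : ∀ n k → k ≤ n → Q s p k < q ^ suc (J n)
      Q<q^[J+1] n k k≤n = begin-strict
        Q s p k              ≤⟨ Q≤ s p k ⟩
        k ^ p + 1            ≤⟨ pow-+1 k p p≥1 ⟩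
        (k + 1) ^ p          ≤⟨ ^-monoˡ-≤ p (+-monoˡ-≤ 1 k≤n) ⟩
        (n + 1) ^ p          <⟨ ^-monoˡ-< p {{>-nonZero p≥1}} (subst (_< 2 ^ L n) (+-comm 1 n) (proj₁ (L-bounds n))) ⟩
        (2 ^ L n) ^ p        ≡⟨ ^-*-assoc 2 (L n) p ⟩
        2 ^ J n              ≤⟨ ^-monoˡ-≤ (J n) (prime≥2 pq) ⟩
        q ^ J n              ≤⟨ ^-monoʳ-≤ q {{>-nonZero (prime≥1 pq)}} (n≤1+n (J n)) ⟩
        q ^ suc (J n)        ∎
        where open ≤-Reasoning

      term-levels : ∀ n k → 1 ≤ k → k ≤ n → term k ≡ Σ< (J n) (λ j → χ (n₀ <? k) * hit (suc j) k)
      term-levels n k k≥1 k≤n with n₀ <? k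
      ... | no _ = sym (Σ-zero (J n))
      ... | yes n₀<k = trans (+-identityʳ _) (trans (ν-sum q (Q s p k) (J n) pq (Q≥1 k n₀<k) (Q<q^[J+1] n k k≤n))
          (sym (Σ-ext (J n) (λ j → trans (+-identityʳ _) (χ-cong (dec∣ (+ (q ^ suc j)) ((+ k) ℤ.^ p ℤ.- τ s)) (q ^ suc j ∣? Q s p k)
             (proj₂ (∣Q⇔ s p k (q ^ suc j) k≥1)) (proj₁ (∣Q⇔ s p k (q ^ suc j) k≥1)))))))

      level : ℕ → ℕ → ℕ
      level n j = Σ< n (λ i → χ (n₀ <? suc i) * hit (suc j) (suc i))

      ν-t-levels : ∀ n → ν q (t s p n₀ n) ≡ Σ< (J n) (level n)
      ν-t-levels n = trans (ν-t n) (trans (Σ-cong n (λ i i<n → term-levels n (suc i) (s≤s z≤n) i<n))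
                       (Σ-swap n (J n) (λ i j → χ (n₀ <? suc i) * hit (suc j) (suc i))))

      level≤ : ∀ n j → level n j ≤ Σ< n (λ i → hit (suc j) (suc i))
      level≤ n j = Σ-mono n (λ i _ → ≤-trans (*-monoˡ-≤ (hit (suc j) (suc i)) (χ≤1 (n₀ <? suc i))) (≤-reflexive (*-identityˡ _)))

      level≥ : ∀ n j → Σ< n (λ i → hit (suc j) (suc i)) ≤ level n j + n₀
      level≥ n j = begin
        Σ< n (λ i → f (suc i))                                               ≤⟨ Σ-mono n split ⟩
        Σ< n (λ i → χ (n₀ <? suc i) * f (suc i) + χ (i <? n₀))               ≡⟨ Σ-+ n _ _ ⟩
        level n j + Σ< n (λ i → χ (i <? n₀))                                 ≡⟨ cong (λ z → level n j + z) (countLt n n₀) ⟩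
        level n j + n ⊓ n₀                                                   ≤⟨ +-monoʳ-≤ _ (m⊓n≤n n n₀) ⟩
        level n j + n₀                                                       ∎
        where
        open ≤-Reasoning
        f : ℕ → ℕ
        f = hit (suc j)
        split : ∀ i → i < n → f (suc i) ≤ χ (n₀ <? suc i) * f (suc i) + χ (i <? n₀)
        split i _ with n₀ <? suc i
        ... | yes _ = ≤-trans (≤-reflexive (sym (+-identityʳ (f (suc i))))) (m≤m+n (f (suc i) + 0) _)
        ... | no n₀≮ = ≤-trans (χ≤1 _) (≤-trans (≤-reflexive (sym (χ-yes (i <? n₀) (≤-pred (≰⇒> n₀≮))))) (m≤n+m _ _))

      module Squeeze (d : ℕ → ℕ) (d≢0 : ∀ j → NonZero (d j)) (r : ℕ → ℕ)
                     (periodic : ∀ j i → hit (suc j) (i + d j) ≡ hit (suc j) i)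
                     (per-period : ∀ j → Σ< (d j) (hit (suc j)) ≡ r j) where

        density : ℕ → ℕ → ℕ
        density n j = r j * (n / d j) {{d≢0 j}}

        ν-t-upper : ∀ n → ν q (t s p n₀ n) ≤ Σ< (J n) (density n) + Σ< (J n) r
        ν-t-upper n = begin
          ν q (t s p n₀ n)                                   ≡⟨ ν-t-levels n ⟩
          Σ< (J n) (level n)                                 ≤⟨ Σ-mono (J n) (λ j _ → ≤-trans (level≤ n j)
                                                                  (periodic-count-upper (d j) {{d≢0 j}} (hit (suc j)) (periodic j) (r j) (per-period j) n)) ⟩
          Σ< (J n) (λ j → density n j + r j)                 ≡⟨ Σ-+ (J n) (density n) r ⟩
          Σ< (J n) (density n) + Σ< (J n) r                  ∎
          where open ≤-Reasoning

        ν-t-lower : ∀ n → Σ< (J n) (density n) ≤ ν q (t s p n₀ n) + J n * n₀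
        ν-t-lower n = begin
          Σ< (J n) (density n)                               ≤⟨ Σ-mono (J n) (λ j _ → ≤-trans
                                                                  (periodic-count-lower (d j) {{d≢0 j}} (hit (suc j)) (periodic j) (r j) (per-period j) n) (level≥ n j)) ⟩
          Σ< (J n) (λ j → level n j + n₀)                    ≡⟨ Σ-+ (J n) (level n) (λ _ → n₀) ⟩
          Σ< (J n) (level n) + Σ< (J n) (λ _ → n₀)           ≡⟨ cong₂ _+_ (sym (ν-t-levels n)) (Σ-const (J n) n₀) ⟩
          ν q (t s p n₀ n) + J n * n₀                        ∎
          where open ≤-Reasoning

    J-log : ∀ c n → c * J n ≤ c * p * (L n + 1)
    J-log c n = ≤-trans (≤-reflexive (reassoc c (L n) p)) (*-monoʳ-≤ (c * p) (m≤m+n (L n) 1))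
      where reassoc : ∀ c L p → c * (L * p) ≡ c * p * L
            reassoc = ℕ-Solver.solve-∀

module ValuationAtQ where

  -- Level j has period q^(j+1) and g hits per period (Hensel), so
  -- ν_q(t_n) = g Σ_{j<J} ⌊n/q^(j+1)⌋ + O(J), and the Legendre sum satisfies
  -- (q - 1) Σ_{j<J} ⌊n/q^(j+1)⌋ = n + O(J) with J = O(L n).

  open import Defs
  open FiniteSums
  open Valuation using (prime≥1; prime≥2)
  open Hensel using (module Lifting)
  open BinaryLength using (L; n<b^L)
  open Legendre using (module LegendreSum)
  open Asymptotics using (log-error⇒∼)
  open Recurrence
  open import Data.Nat as ℕ
  open import Data.Nat.Properties
  open import Data.Nat.Divisibility as ℕD using (_∣_)
  open import Data.Nat.Primality
  open import Data.Nat.GCD using (gcd; gcd[m,n]∣m)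
  open import Data.Product using (_×_; _,_; proj₁; proj₂)
  open import Relation.Nullary
  open import Relation.Binary.PropositionalEquality hiding (J)
  import Data.Nat.Tactic.RingSolver as ℕ-Solver

  squeeze-q : ∀ ν G J g M' n n₀ → ν ≤ g * G + J * g → g * G ≤ ν + J * n₀ → M' * G ≤ n → n ≤ M' * G + suc M' * J →
    (M' * ν ≤ g * n + (M' * g + M' * n₀ + g * suc M') * J) × (g * n ≤ M' * ν + (M' * g + M' * n₀ + g * suc M') * J)
  squeeze-q ν G J g M' n n₀ ν≤ gG≤ M'G≤n n≤ = upper , lower
    where
    c : ℕ
    c = M' * g + M' * n₀ + g * suc M'
    upper : M' * ν ≤ g * n + c * J
    upper = begin
      M' * ν                        ≤⟨ *-monoʳ-≤ M' ν≤ ⟩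
      M' * (g * G + J * g)          ≡⟨ regroup M' g G J ⟩
      g * (M' * G) + M' * g * J     ≤⟨ +-mono-≤ (*-monoʳ-≤ g M'G≤n) (*-monoˡ-≤ J (≤-trans (m≤m+n (M' * g) (M' * n₀)) (m≤m+n _ (g * suc M')))) ⟩
      g * n + c * J                 ∎
      where open ≤-Reasoning
            regroup : ∀ M' g G J → M' * (g * G + J * g) ≡ g * (M' * G) + M' * g * J
            regroup = ℕ-Solver.solve-∀
    lower : g * n ≤ M' * ν + c * J
    lower = begin
      g * n                                   ≤⟨ *-monoʳ-≤ g n≤ ⟩
      g * (M' * G + suc M' * J)               ≡⟨ regroup₁ g M' G J ⟩
      M' * (g * G) + g * suc M' * J           ≤⟨ +-monoˡ-≤ _ (*-monoʳ-≤ M' gG≤) ⟩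
      M' * (ν + J * n₀) + g * suc M' * J      ≡⟨ regroup₂ M' ν J n₀ g ⟩
      M' * ν + (M' * n₀ + g * suc M') * J     ≤⟨ +-monoʳ-≤ (M' * ν) (*-monoˡ-≤ J (≤-trans (m≤n+m _ (M' * g)) (≤-reflexive (sym (+-assoc (M' * g) (M' * n₀) (g * suc M')))))) ⟩
      M' * ν + c * J                          ∎
      where open ≤-Reasoning
            regroup₁ : ∀ g M' G J → g * (M' * G + suc M' * J) ≡ M' * (g * G) + g * suc M' * J
            regroup₁ = ℕ-Solver.solve-∀
            regroup₂ : ∀ M' ν J n₀ g → M' * (ν + J * n₀) + g * suc M' * J ≡ M' * ν + (M' * n₀ + g * suc M') * J
            regroup₂ = ℕ-Solver.solve-∀

  ν-at-q : ∀ p (pp : Prime p) (odd : ¬ (2 ∣ p)) (s : PM) (n₀ : ℕ) (zeros<n₀ : ∀ (x : ℕ) → 1 ≤ x → Q s p x ≡ 0 → x < n₀) →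
           ∀ q → Prime q → q ≢ p →
           ((λ n → toℚ (ν q (t s p n₀ n))) ∼ (λ n → toℚ (gcd p (q ∸ 1) * n) ÷₀ toℚ (q ∸ 1)))
  ν-at-q p pp odd s n₀ zeros<n₀ (suc M') pq q≢p =
    log-error⇒∼ (λ n → ν q (t s p n₀ n)) g M' (c * p) g≥1 (≤-pred (prime≥2 pq)) bounds
    where
    q : ℕ
    q = suc M'
    open Setup p pp s n₀ zeros<n₀
    open AtPrime q pq
    open Lifting q p pq pp q≢p odd (τ s) (τ-sign s) using (hit-periodic; roots-all)
    g : ℕ
    g = gcd p M'
    g≥1 : 1 ≤ g
    g≥1 = n≢0⇒n>0 (λ g≡0 → <-irrefl refl (≤-trans (prime≥1 pp) (≤-reflexive (ℕD.0∣⇒≡0 (subst (_∣ p) g≡0 (gcd[m,n]∣m p M'))))))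
    c : ℕ
    c = M' * g + M' * n₀ + g * q

    open Squeeze (λ j → q ^ suc j) (λ j → m^n≢0 q (suc j)) (λ _ → g) (λ j → hit-periodic (suc j)) roots-all

    density-sum : ∀ n → Σ< (J n) (density n) ≡ g * LegendreSum.S M' n (J n)
    density-sum n = Σ-*ˡ (J n) g _

    -- The Legendre sum of length J n is complete: n < q ^ J n.
    n<q^J : ∀ n → n < q ^ J n
    n<q^J n = <-≤-trans (n<b^L q (prime≥2 pq) n) (^-monoʳ-≤ q (m≤m*n (L n) p {{>-nonZero (prime≥1 pp)}}))

    bounds : ∀ n → (M' * ν q (t s p n₀ n) ≤ g * n + c * p * (L n + 1)) × (g * n ≤ M' * ν q (t s p n₀ n) + c * p * (L n + 1))
    bounds n = ≤-trans (proj₁ squeezed) (+-monoʳ-≤ (g * n) (J-log c n))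
             , ≤-trans (proj₂ squeezed) (+-monoʳ-≤ (M' * νₙ) (J-log c n))
      where
      νₙ : ℕ
      νₙ = ν q (t s p n₀ n)
      G : ℕ
      G = LegendreSum.S M' n (J n)
      upper : νₙ ≤ g * G + J n * g
      upper = subst₂ (λ a b → νₙ ≤ a + b) (density-sum n) (Σ-const (J n) g) (ν-t-upper n)
      lower : g * G ≤ νₙ + J n * n₀
      lower = subst (_≤ νₙ + J n * n₀) (density-sum n) (ν-t-lower n)
      squeezed : (M' * νₙ ≤ g * n + c * J n) × (g * n ≤ M' * νₙ + c * J n)
      squeezed = squeeze-q νₙ G (J n) g M' n n₀ upper lower
                   (LegendreSum.legendre-upper M' n (J n)) (LegendreSum.legendre-lower M' n (J n) (n<q^J n))

module ValuationAtP where

  -- By lifting the exponent, level 0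
  -- has period p and level j ≥ 1 has period p ^ j, each with one hit per
  -- period, so ν_p(t_n) = ⌊n/p⌋ + Σ_{j<J'} ⌊n/p^(j+1)⌋ + O(J) with
  -- p ⌊n/p⌋ = n + O(1) and (p - 1) Σ_{j<J'} ⌊n/p^(j+1)⌋ = n + O(J); hence
  -- p (p - 1) ν_p(t_n) = (p - 1) n + p n + O(L n) = (2p - 1) n + O(L n).

  open import Defs
  open FiniteSums
  open Valuation using (prime≥2)
  open LiftingTheExponent using (module LTE; InClass-periodic; InClass-period)
  open BinaryLength using (L; L≥1; n<b^L)
  open Legendre using (module LegendreSum)
  open Asymptotics using (log-error⇒∼)
  open Recurrence
  open import Data.Nat as ℕ
  open import Data.Nat.Properties
  open import Data.Nat.DivMod
  open import Data.Nat.Divisibility using (_∣_)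
  open import Data.Nat.Primality
  open import Data.Product using (Σ; _×_; _,_; proj₁; proj₂)
  open import Relation.Nullary
  open import Relation.Binary.PropositionalEquality hiding (J)
  import Data.Nat.Tactic.RingSolver as ℕ-Solver

  squeeze-p : ∀ ν a₀ G J' n n₀ p' →
    ν ≤ a₀ + G + suc J' → a₀ + G ≤ ν + suc J' * n₀ → p' * G ≤ n → n ≤ p' * G + suc p' * J' →
    suc p' * a₀ ≤ n → n ≤ suc p' * a₀ + suc p' →
    (suc p' * p' * ν ≤ (p' + suc p') * n + (suc p' * p' * n₀ + suc p' * p' + suc p' * suc p') * suc J') ×
    ((p' + suc p') * n ≤ suc p' * p' * ν + (suc p' * p' * n₀ + suc p' * p' + suc p' * suc p') * suc J')
  squeeze-p ν a₀ G J' n n₀ p' ν≤ a₀+G≤ p'G≤n n≤p'G+pJ' pa₀≤n n≤pa₀+p = upper , lower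
    where
    p : ℕ
    p = suc p'
    D : ℕ
    D = p * p'
    c : ℕ
    c = D * n₀ + D + p * p
    J : ℕ
    J = suc J'
    upper : D * ν ≤ (p' + p) * n + c * J
    upper = begin
      D * ν ≤⟨ *-monoʳ-≤ D ν≤ ⟩
      D * (a₀ + G + J) ≡⟨ regroup₁ p' a₀ G J ⟩
      p' * (p * a₀) + p * (p' * G) + D * J ≤⟨ +-mono-≤ (+-mono-≤ (*-monoʳ-≤ p' pa₀≤n) (*-monoʳ-≤ p p'G≤n)) (*-monoˡ-≤ J (≤-trans (m≤n+m D (D * n₀)) (m≤m+n _ (p * p)))) ⟩
      p' * n + p * n + c * J ≡⟨ cong (_+ c * J) (sym (*-distribʳ-+ n p' p)) ⟩
      (p' + p) * n + c * J ∎
      where open ≤-Reasoning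
            regroup₁ : ∀ p' a₀ G J → suc p' * p' * (a₀ + G + J) ≡ p' * (suc p' * a₀) + suc p' * (p' * G) + suc p' * p' * J
            regroup₁ = ℕ-Solver.solve-∀
    lower : (p' + p) * n ≤ D * ν + c * J
    lower = begin
      (p' + p) * n ≡⟨ *-distribʳ-+ n p' p ⟩
      p' * n + p * n ≤⟨ +-mono-≤ (*-monoʳ-≤ p' n≤pa₀+p) (*-monoʳ-≤ p n≤p'G+pJ') ⟩
      p' * (p * a₀ + p) + p * (p' * G + p * J') ≡⟨ regroup₂ p' a₀ G J' ⟩
      D * (a₀ + G) + (D + p * p * J') ≤⟨ +-monoˡ-≤ _ (*-monoʳ-≤ D a₀+G≤) ⟩
      D * (ν + J * n₀) + (D + p * p * J') ≡⟨ regroup₃ p' ν J n₀ J' ⟩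
      D * ν + (D * n₀ * J + D + p * p * J') ≤⟨ +-monoʳ-≤ (D * ν) (+-mono-≤ (+-monoʳ-≤ (D * n₀ * J) (m≤m*n D J)) (*-monoʳ-≤ (p * p) (n≤1+n J'))) ⟩
      D * ν + (D * n₀ * J + D * J + p * p * J) ≡⟨ cong (D * ν +_) (regroup₄ p' n₀ J) ⟩
      D * ν + c * J ∎
      where open ≤-Reasoning
            regroup₂ : ∀ p' a₀ G J' → p' * (suc p' * a₀ + suc p') + suc p' * (p' * G + suc p' * J') ≡ suc p' * p' * (a₀ + G) + (suc p' * p' + suc p' * suc p' * J')
            regroup₂ = ℕ-Solver.solve-∀
            regroup₃ : ∀ p' ν J n₀ J' → suc p' * p' * (ν + J * n₀) + (suc p' * p' + suc p' * suc p' * J') ≡ suc p' * p' * ν + (suc p' * p' * n₀ * J + suc p' * p' + suc p' * suc p' * J')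
            regroup₃ = ℕ-Solver.solve-∀
            regroup₄ : ∀ p' n₀ J → suc p' * p' * n₀ * J + suc p' * p' * J + suc p' * suc p' * J ≡ (suc p' * p' * n₀ + suc p' * p' + suc p' * suc p') * J
            regroup₄ = ℕ-Solver.solve-∀

  -- J n = J' + 1 with L n ≤ J', since J n = p · L n and p ≥ 2.
  levels-split : ∀ p' → 1 ≤ p' → ∀ n → Σ ℕ λ J' → (L n * suc p' ≡ suc J') × (L n ≤ J')
  levels-split p' p'≥1 n with L n | L≥1 n
  ... | _ | l , refl = p' + l * suc p' , refl , +-mono-≤ p'≥1 (m≤m*n l (suc p'))

  ν-at-p : ∀ p (pp : Prime p) (odd : ¬ (2 ∣ p)) (s : PM) (n₀ : ℕ) (zeros<n₀ : ∀ (x : ℕ) → 1 ≤ x → Q s p x ≡ 0 → x < n₀) →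
           (λ n → toℚ (ν p (t s p n₀ n))) ∼ (λ n → toℚ ((2 * p ∸ 1) * n) ÷₀ toℚ (p * (p ∸ 1)))
  ν-at-p (suc p') pp odd s n₀ zeros<n₀ =
    log-error⇒∼ (λ n → ν p (t s p n₀ n)) (2 * p ∸ 1) (p * p') (c * p) A≥1 (*-mono-≤ {1} {p} {1} {p'} (s≤s z≤n) p'≥1) bounds
    where
    p : ℕ
    p = suc p'
    p'≥1 : 1 ≤ p'
    p'≥1 = ≤-pred (prime≥2 pp)
    open Setup p pp s n₀ zeros<n₀
    open AtPrime p pp
    open LTE p pp odd using (lte-modulus; lte-modulus≥1; Hit≡InClass)
    2p-1≡ : 2 * p ∸ 1 ≡ p' + p
    2p-1≡ = cong (p' +_) (+-identityʳ p)
    A≥1 : 1 ≤ 2 * p ∸ 1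
    A≥1 = subst (1 ≤_) (sym 2p-1≡) (≤-trans (s≤s z≤n) (m≤n+m p p'))
    c : ℕ
    c = p * p' * n₀ + p * p' + p * p

    d≢0 : ∀ j → NonZero (lte-modulus j)
    d≢0 j = >-nonZero (lte-modulus≥1 j)

    periodic : ∀ j i → hit (suc j) (i + lte-modulus j) ≡ hit (suc j) i
    periodic j i = trans (Hit≡InClass (τ-sign s) j _) (trans (InClass-periodic (lte-modulus j) (τ s) i) (sym (Hit≡InClass (τ-sign s) j i)))

    one-per-period : ∀ j → Σ< (lte-modulus j) (hit (suc j)) ≡ 1
    one-per-period j = trans (Σ-ext (lte-modulus j) (Hit≡InClass (τ-sign s) j)) (InClass-period (lte-modulus j) (τ s) (lte-modulus≥1 j))

    open Squeeze lte-modulus d≢0 (λ _ → 1) periodic one-per-period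

    density-sum : ∀ n J' → J n ≡ suc J' → Σ< (J n) (density n) ≡ n / p + LegendreSum.S p' n J'
    density-sum n J' J≡ = trans (Σ-ext (J n) (λ j → *-identityˡ _)) (cong (λ z → Σ< z (λ j → (n / lte-modulus j) {{d≢0 j}})) J≡)

    bounds : ∀ n → (p * p' * ν p (t s p n₀ n) ≤ (2 * p ∸ 1) * n + c * p * (L n + 1))
                 × ((2 * p ∸ 1) * n ≤ p * p' * ν p (t s p n₀ n) + c * p * (L n + 1))
    bounds n = ≤-trans (proj₁ squeezed) (+-mono-≤ (≤-reflexive (cong (_* n) (sym 2p-1≡))) J-bound)
             , ≤-trans (≤-reflexive (cong (_* n) 2p-1≡)) (≤-trans (proj₂ squeezed) (+-monoʳ-≤ _ J-bound))
      where
      J' : ℕ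
      J' = proj₁ (levels-split p' p'≥1 n)
      J≡ : J n ≡ suc J'
      J≡ = proj₁ (proj₂ (levels-split p' p'≥1 n))
      L≤J' : L n ≤ J'
      L≤J' = proj₂ (proj₂ (levels-split p' p'≥1 n))
      νₙ : ℕ
      νₙ = ν p (t s p n₀ n)
      G : ℕ
      G = LegendreSum.S p' n J'
      upper : νₙ ≤ n / p + G + suc J'
      upper = subst (νₙ ≤_) (cong₂ _+_ (density-sum n J' J≡) (trans (Σ-const (J n) 1) (trans (*-identityʳ (J n)) J≡))) (ν-t-upper n)
      lower : n / p + G ≤ νₙ + suc J' * n₀
      lower = subst₂ _≤_ (density-sum n J' J≡) (cong (λ z → νₙ + z * n₀) J≡) (ν-t-lower n)
      n≤p⌊n/p⌋+p : n ≤ p * (n / p) + p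
      n≤p⌊n/p⌋+p = begin
        n                        ≡⟨ m≡m%n+[m/n]*n n p ⟩
        n % p + (n / p) * p      ≤⟨ +-monoˡ-≤ ((n / p) * p) (<⇒≤ (m%n<n n p)) ⟩
        p + (n / p) * p          ≡⟨ trans (+-comm p ((n / p) * p)) (cong (_+ p) (*-comm (n / p) p)) ⟩
        p * (n / p) + p          ∎
        where open ≤-Reasoning
      squeezed : (p * p' * νₙ ≤ (p' + p) * n + c * suc J') × ((p' + p) * n ≤ p * p' * νₙ + c * suc J')
      squeezed = squeeze-p νₙ (n / p) G J' n n₀ p' upper lower
                   (LegendreSum.legendre-upper p' n J')
                   (LegendreSum.legendre-lower p' n J' (<-≤-trans (n<b^L p (prime≥2 pp) n) (^-monoʳ-≤ p L≤J')))
                   (subst (_≤ n) (*-comm (n / p) p) (m/n*n≤m n p))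
                   n≤p⌊n/p⌋+p
      J-bound : c * suc J' ≤ c * p * (L n + 1)
      J-bound = subst (λ z → c * z ≤ c * p * (L n + 1)) J≡ (J-log c n)

open import Defs
open import Data.Nat using (ℕ; _*_; _∸_; _+_; _≤_; _<_; zero; suc)
open import Data.Nat.Divisibility using (_∣_)
open import Data.Nat.Primality using (Prime)
open import Data.Nat.GCD using (gcd)
open import Data.Product using (_×_; _,_)
open import Relation.Nullary using (¬_)
open import Relation.Binary.PropositionalEquality using (_≡_; _≢_)
open ValuationAtP using (ν-at-p)
open ValuationAtQ using (ν-at-q)

corollary3p8 : (p : ℕ) → Prime p → ¬ (2 ∣ p) →
    (s : PM) → (n₀ : ℕ) →
    (∀ (x : ℕ) → 1 ≤ x → Q s p x ≡ 0 → x < n₀) →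
    ((λ n → toℚ (ν p (t s p n₀ n))) ∼ (λ n → toℚ ((2 * p ∸ 1) * n) ÷₀ toℚ (p * (p ∸ 1))))
    × (∀ (q : ℕ) → Prime q → q ≢ p →
    ((λ n → toℚ (ν q (t s p n₀ n))) ∼ (λ n → toℚ (gcd p (q ∸ 1) * n) ÷₀ toℚ (q ∸ 1))))
corollary3p8 p pp odd s n₀ zeros<n₀ = ν-at-p p pp odd s n₀ zeros<n₀ , ν-at-q p pp odd s n₀ zeros<n₀
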